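{- Let $n\ge4$. The facets of $\Delta^3_n$ are exactly the following sets together with their antipodes ($-F=\{ -v:v\in F\}$): (1) $\{i,i+1,n-1,n\}$ and $\{ -i,-i-1,n-1,n\}$ for $1\le i\le n-3$; $\{1,-n+2,n-1,n\}$, $\{1,-n+2,-n+1,n\}$, $\{1,-n+2,-n+1,-n\}$; (2) $\{i,i+1,\ell,\ell+2\}$, $\{ -i,-i-1,\ell,\ell+2\}$, $\{1,-\ell+1,\ell,\ell+2\}$ for $1\le i$, $i+1<\ell\le n-2$; $\{\ell,\ell+1,\ell+2,-\ell-3\}$ and $\{ -1,\ell,\ell+2,-\ell-3\}$ for $2\le\ell\le n-3$; (3) $\{1,2,-3,4\}$, $\{1,2,3,-4\}$, $\{1,-2,3,-4\}$. Moreover, the sets in (1) together with their antipodes are exactly the facets of $B^{3,1}_n\cup(-B^{3,1}_n)$; the sets in (2) together with their antipodes are exactly the facets of $\bigcup_{s=5}^n\big(\pm(\partial B^{3,1}_{s-1}*s)\setminus\pm B^{3,1}_s\big)$; and the sets in (3) together with their antipodes are exactly the facets of $\Delta^3_4\setminus(\pm B^{3,1}_4)$.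
   Context: Simplicial complexes are finite abstract simplicial complexes; $\overline{A}$ is the simplex of all subsets of a finite set $A$. $V_m=\{\pm1,\dots,\pm m\}$; $-\sigma=\{ -v:v\in\sigma\}$, $-\Gamma=\{ -\sigma:\sigma\in\Gamma\}$; $\pm\Gamma$ denotes $\Gamma\cup(-\Gamma)$. The join is $\Gamma*\Gamma'=\{\sigma\cup\tau\}$, $\Gamma*v:=\Gamma*\overline{\{v\}}$; a path/cycle $(v_1,\dots,v_m)$ is the 1-dimensional complex with edges $\{v_j,v_{j+1}\}$. $\partial C^*_m$ is the complex of all subsets of $V_m$ with no pair $\{j,-j\}$. For pure $\Delta$ and pure full-dimensional subcomplex $\Gamma$, $\Delta\setminus\Gamma$ is generated by facets of $\Delta$ not in $\Gamma$; $\partial B$ is the boundary of a combinatorial ball $B$. Recursive definition: $\Delta^1_n=(1,\dots,n,-1,\dots,-n,1)$; $\Delta^d_{d+1}=\partial C^*_{d+1}$; $B^{d,j}_n=\emptyset$ for $j<0$; $B^{1,0}_n=\overline{\{ -1,n\}}$; $B^{2k-1,k}_n=\Delta^{2k-1}_n\setminus B^{2k-1,k-1}_n$ ($k\ge1$, $n\ge 2k$); $B^{d,i}_n=(B^{d-1,i}_{n-1}*n)\cup((-B^{d-1,i-1}_{n-1})*(-n))$ ($d\ge2$, $n\ge d+1$, $i\le\lfloor d/2\rfloor$); $\Delta^d_{n+1}$ is obtained from $\Delta^d_n$ by replacing $B=B^{d,\lceil d/2\rceil-1}_n$ with $\partial B*(n+1)$ and $-B$ with $\partial(-B)*(-n-1)$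 (known to be well defined; $B^{3,1}_n$ is a combinatorial 3-ball contained in $\Delta^3_n$). -}

module Defs where

open import Data.Bool using (Bool; true; false; not; _∧_)
open import Data.Nat as ℕ using (ℕ; zero; suc; _+_; _∸_; _≤_; _<_)
open import Data.Integer as ℤ using (ℤ; +_; -_)
open import Data.List using (List; []; _∷_; _++_; [_]; map; concatMap; filterᵇ; length; applyUpTo)
open import Data.Bool.ListAction using (any; all)
open import Data.List.Membership.Propositional using (_∈_)
open import Data.List.Relation.Unary.Any using (Any)
open import Data.Product using (Σ; _×_; ∃-syntax)
open import Data.Sum using (_⊎_)
open import Relation.Nullary.Decidable using (⌊_⌋)
open import Relation.Binary.PropositionalEquality using (_≡_)

-- Vertices are nonzero integers (vertex j ∈ V_m is the integer j, −j is −j).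
-- A face/simplex is a finite set of vertices, represented by a list
-- (order and repetitions irrelevant: everything below is up to set equality).
-- A (pure) simplicial complex is represented by a list of generating faces;
-- the complex is the set of all subsets of the generators.

Face : Set
Face = List ℤ

Cx : Set
Cx = List Face

p : ℕ → ℤ
p k = + k

m : ℕ → ℤ
m k = - (+ k)

_⊆_ : Face → Face → Set
σ ⊆ τ = ∀ x → x ∈ σ → x ∈ τ

_≐_ : Face → Face → Set
σ ≐ τ = (σ ⊆ τ) × (τ ⊆ σ)

FaceOf : Cx → Face → Set
FaceOf Γ σ = Any (λ G → σ ⊆ G) Γ

IsFacet : Cx → Face → Set
IsFacet Γ σ = FaceOf Γ σ × (∀ τ → FaceOf Γ τ → σ ⊆ τ → τ ⊆ σ)

_∈ᵇ_ : ℤ → Face → Bool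
x ∈ᵇ σ = any (λ y → ⌊ x ℤ.≟ y ⌋) σ

_⊆ᵇ_ : Face → Face → Bool
σ ⊆ᵇ τ = all (λ x → x ∈ᵇ τ) σ

isFaceᵇ : Face → Cx → Bool
isFaceᵇ σ Γ = any (λ G → σ ⊆ᵇ G) Γ

neg : Face → Face
neg = map -_

negC : Cx → Cx
negC = map neg

pm : Cx → Cx
pm Γ = Γ ++ negC Γ

join : ℤ → Cx → Cx
join v Γ = map (v ∷_) Γ

-- Δ ∖ Γ : generated by the facets of Δ that are not faces of Γ
_∖_ : Cx → Cx → Cx
Δ ∖ Γ = filterᵇ (λ F → not (isFaceᵇ F Γ)) Δ

removeV : ℤ → Face → Face
removeV v = filterᵇ (λ x → not ⌊ x ℤ.≟ v ⌋)

ridges : Cx → Cx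
ridges B = concatMap (λ G → map (λ v → removeV v G) G) B

-- boundary of a (pure) combinatorial ball B: generated by the
-- codimension-one faces contained in exactly one facet of B
∂ : Cx → Cx
∂ B = filterᵇ (λ r → ⌊ length (filterᵇ (λ G → r ⊆ᵇ G) B) ℕ.≟ 1 ⌋) (ridges B)

pathEdges : List ℤ → Cx
pathEdges (a ∷ b ∷ rest) = (a ∷ b ∷ []) ∷ pathEdges (b ∷ rest)
pathEdges _ = []

cycle : List ℤ → Cx
cycle [] = []
cycle (x ∷ xs) = pathEdges ((x ∷ xs) ++ [ x ])

-- The complexes of the paper (the recursive definitions specialised to
-- dimensions d ≤ 3, which is all that Δ³ₙ and B^{3,1}ₙ depend on)

Δ1 : ℕ → Cx
Δ1 n = cycle (applyUpTo (λ j → p (suc j)) n ++ applyUpTo (λ j → m (suc j)) n)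

B10 : ℕ → Cx
B10 n = (m 1 ∷ p n ∷ []) ∷ []

B11 : ℕ → Cx
B11 n = Δ1 n ∖ B10 n

-- B^{2,0}ₙ = (B^{1,0}_{n−1} * n) ∪ ((−B^{1,−1}_{n−1}) * (−n)),  B^{1,−1} = ∅
B20 : ℕ → Cx
B20 n = join (p n) (B10 (n ∸ 1)) ++ join (m n) (negC [])

B21 : ℕ → Cx
B21 n = join (p n) (B11 (n ∸ 1)) ++ join (m n) (negC (B10 (n ∸ 1)))

B31 : ℕ → Cx
B31 n = join (p n) (B21 (n ∸ 1)) ++ join (m n) (negC (B20 (n ∸ 1)))

-- facets of ∂C*_k : all {ε₁·1,…,ε_k·k} with signs εⱼ
crossBd : ℕ → Cx
crossBd zero = [] ∷ []
crossBd (suc k) = join (p (suc k)) (crossBd k) ++ join (m (suc k)) (crossBd k)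

replace : Cx → Cx → ℤ → Cx
replace Δ B v = (Δ ∖ pm B) ++ join v (∂ B) ++ join (- v) (∂ (negC B))

-- Δ³ₙ for n ≥ 4 (values for n < 4 are irrelevant junk)
Δ3 : ℕ → Cx
Δ3 (suc n@(suc (suc (suc (suc _))))) = replace (Δ3 n) (B31 n) (p (suc n))
Δ3 4 = crossBd 4
Δ3 _ = []

Fam1 : ℕ → Face → Set
Fam1 n F =
    (∃[ i ] (1 ≤ i × i ≤ n ∸ 3 × F ≐ (p i ∷ p (i + 1) ∷ p (n ∸ 1) ∷ p n ∷ [])))
  ⊎ (∃[ i ] (1 ≤ i × i ≤ n ∸ 3 × F ≐ (m i ∷ m (i + 1) ∷ p (n ∸ 1) ∷ p n ∷ [])))
  ⊎ (F ≐ (p 1 ∷ m (n ∸ 2) ∷ p (n ∸ 1) ∷ p n ∷ []))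
  ⊎ (F ≐ (p 1 ∷ m (n ∸ 2) ∷ m (n ∸ 1) ∷ p n ∷ []))
  ⊎ (F ≐ (p 1 ∷ m (n ∸ 2) ∷ m (n ∸ 1) ∷ m n ∷ []))

Fam2 : ℕ → Face → Set
Fam2 n F =
    (∃[ i ] ∃[ ℓ ] (1 ≤ i × i + 1 < ℓ × ℓ ≤ n ∸ 2 × F ≐ (p i ∷ p (i + 1) ∷ p ℓ ∷ p (ℓ + 2) ∷ [])))
  ⊎ (∃[ i ] ∃[ ℓ ] (1 ≤ i × i + 1 < ℓ × ℓ ≤ n ∸ 2 × F ≐ (m i ∷ m (i + 1) ∷ p ℓ ∷ p (ℓ + 2) ∷ [])))
  ⊎ (∃[ i ] ∃[ ℓ ] (1 ≤ i × i + 1 < ℓ × ℓ ≤ n ∸ 2 × F ≐ (p 1 ∷ m (ℓ ∸ 1) ∷ p ℓ ∷ p (ℓ + 2) ∷ [])))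
  ⊎ (∃[ ℓ ] (2 ≤ ℓ × ℓ ≤ n ∸ 3 × F ≐ (p ℓ ∷ p (ℓ + 1) ∷ p (ℓ + 2) ∷ m (ℓ + 3) ∷ [])))
  ⊎ (∃[ ℓ ] (2 ≤ ℓ × ℓ ≤ n ∸ 3 × F ≐ (m 1 ∷ p ℓ ∷ p (ℓ + 2) ∷ m (ℓ + 3) ∷ [])))

Fam3 : Face → Set
Fam3 F =
    (F ≐ (p 1 ∷ p 2 ∷ m 3 ∷ p 4 ∷ []))
  ⊎ (F ≐ (p 1 ∷ p 2 ∷ p 3 ∷ m 4 ∷ []))
  ⊎ (F ≐ (p 1 ∷ m 2 ∷ p 3 ∷ m 4 ∷ []))

WithAntipodes : (Face → Set) → Face → Set
WithAntipodes P F = P F ⊎ P (neg F)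

Union2 : ℕ → Cx
Union2 n = concatMap (λ s → pm (join (p s) (∂ (B31 (s ∸ 1)))) ∖ pm (B31 s))
                     (applyUpTo (λ j → 5 + j) (n ∸ 4))

module Submission where

-- Every complex below is presented by a list of generating 4-sets, so its facets are exactly
-- its generators up to set equality (two 4-sets cannot be strictly nested), and it suffices
-- to compute generator lists. The facets of B^{3,1}_N are explicit: {N, N−1} ∪ e for the
-- edges e of the path B^{1,1}_{N−2}, together with {N, −(N−1), 1, −(N−2)} and
-- {−N, −(N−1), 1, −(N−2)}; these are the sets (1). A ridge of B^{3,1}_N lies on the boundary
-- iff no second facet contains it, which leaves ten kinds of triangles; coning them with N+1
-- gives, up to antipodes, the sets (1) for N+1 and the members of (2) for N+1 with
-- ℓ ∈ {N−1, N−2}. By induction on n, passing from Δ³ₙ to Δ³ₙ₊₁ keeps ±(2) and ±(3) (4-sets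
-- that are not facets of ±B^{3,1}ₙ, hence not faces of it) and replaces ±(1) by these cones;
-- the case n = 4 is a finite computation.

open import Defs
open import Data.Nat using (ℕ; _≤_)
open import Data.Product using (_×_)
open import Data.Sum using (_⊎_)
open import Function.Bundles using (_⇔_)

open import Data.Bool using (Bool; true; false; not; T; T?; _∧_)
open import Data.Bool.ListAction using (any; all)
open import Data.Bool.Properties using (T-∧)
open import Data.Empty using (⊥; ⊥-elim)
open import Data.Integer as ℤ using (ℤ; -_; ∣_∣)
import Data.Integer.Properties as ℤ
open import Data.List using (List; []; _∷_; _++_; [_]; map; filterᵇ; length; applyUpTo; concatMap)
import Data.List.Properties as List
open import Data.List.Membership.Propositional using (_∈_; _─_; find; lose)
open import Data.List.Membership.Propositional.Properties
  using (∈-map⁺; ∈-map⁻; ∈-filter⁺; ∈-filter⁻; ∈-concatMap⁺; ∈-concatMap⁻; ∈-++⁻; ∈-++⁺ˡ; ∈-++⁺ʳ)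
open import Data.List.Membership.DecPropositional ℤ._≟_ using (_∈?_)
open import Data.List.Relation.Unary.All as All using (All; []; _∷_)
import Data.List.Relation.Unary.All.Properties as All
open import Data.List.Relation.Unary.AllPairs as AllPairs using (AllPairs; []; _∷_)
import Data.List.Relation.Unary.AllPairs.Properties as AllPairs
open import Data.List.Relation.Unary.Any as Any using (Any; here; there)
import Data.List.Relation.Unary.Any.Properties as Any
open import Data.List.Relation.Unary.Unique.Propositional using (Unique)
open import Data.List.Relation.Unary.Unique.DecPropositional ℤ._≟_ using (unique?)
open import Data.Nat as ℕ using (zero; suc; _+_; _∸_; _<_; z≤n; s≤s)
import Data.Nat.Properties as ℕ
open import Data.Product using (∃-syntax; _,_; proj₁; proj₂)
open import Data.Sum using (inj₁; inj₂; [_,_]′)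
open import Function using (_∘_; case_of_; mk⇔; Equivalence)
open import Function.Properties.Equivalence using () renaming (trans to ⇔-trans)
open import Relation.Nullary using (¬_; yes; no)
open import Relation.Nullary.Decidable using (⌊_⌋; toWitness; fromWitness; _×-dec_)
open import Relation.Binary.PropositionalEquality
  using (_≡_; _≢_; refl; sym; trans; cong; cong₂; subst; subst₂; module ≡-Reasoning)

∈ᵇ⇒∈ : ∀ {x} σ → T (x ∈ᵇ σ) → x ∈ σ
∈ᵇ⇒∈ σ = Any.map toWitness ∘ Any.any⁻ _ σ

∈⇒∈ᵇ : ∀ {x σ} → x ∈ σ → T (x ∈ᵇ σ)
∈⇒∈ᵇ = Any.any⁺ _ ∘ Any.map fromWitness

⊆ᵇ⇒⊆ : ∀ σ τ → T (σ ⊆ᵇ τ) → σ ⊆ τ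
⊆ᵇ⇒⊆ σ τ h x = ∈ᵇ⇒∈ τ ∘ All.lookup (All.all⁺ _ σ h)

⊆⇒⊆ᵇ : ∀ σ τ → σ ⊆ τ → T (σ ⊆ᵇ τ)
⊆⇒⊆ᵇ σ τ s = All.all⁻ _ (All.tabulate (∈⇒∈ᵇ ∘ s _))

isFaceᵇ⇒FaceOf : ∀ σ Γ → T (isFaceᵇ σ Γ) → FaceOf Γ σ
isFaceᵇ⇒FaceOf σ Γ = Any.map (⊆ᵇ⇒⊆ σ _) ∘ Any.any⁻ _ Γ

FaceOf⇒isFaceᵇ : ∀ σ Γ → FaceOf Γ σ → T (isFaceᵇ σ Γ)
FaceOf⇒isFaceᵇ σ Γ = Any.any⁺ _ ∘ Any.map (⊆⇒⊆ᵇ σ _)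

T-not⇒¬T : ∀ {b} → T (not b) → ¬ T b
T-not⇒¬T {false} _ ()

¬T⇒T-not : ∀ {b} → ¬ T b → T (not b)
¬T⇒T-not {false} _ = _
¬T⇒T-not {true} ¬t = ¬t _

⊆-refl : ∀ {σ} → σ ⊆ σ
⊆-refl _ x∈σ = x∈σ

⊆-trans : ∀ {σ τ υ} → σ ⊆ τ → τ ⊆ υ → σ ⊆ υ
⊆-trans σ⊆τ τ⊆υ x = τ⊆υ x ∘ σ⊆τ x

≐-refl : ∀ {σ} → σ ≐ σ
≐-refl = ⊆-refl , ⊆-refl

≐-sym : ∀ {σ τ} → σ ≐ τ → τ ≐ σ
≐-sym (σ⊆τ , τ⊆σ) = τ⊆σ , σ⊆τ

≐-trans : ∀ {σ τ υ} → σ ≐ τ → τ ≐ υ → σ ≐ υ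
≐-trans (σ⊆τ , τ⊆σ) (τ⊆υ , υ⊆τ) = ⊆-trans σ⊆τ τ⊆υ , ⊆-trans υ⊆τ τ⊆σ

⊆-∷⁺ : ∀ {v σ τ} → σ ⊆ τ → (v ∷ σ) ⊆ (v ∷ τ)
⊆-∷⁺ σ⊆τ _ (here x≡v) = here x≡v
⊆-∷⁺ σ⊆τ x (there x∈σ) = there (σ⊆τ x x∈σ)

≐-∷⁺ : ∀ {v σ τ} → σ ≐ τ → (v ∷ σ) ≐ (v ∷ τ)
≐-∷⁺ (σ⊆τ , τ⊆σ) = ⊆-∷⁺ σ⊆τ , ⊆-∷⁺ τ⊆σ

∷-≐-cancel : ∀ {v σ τ} → ¬ v ∈ σ → ¬ v ∈ τ → (v ∷ σ) ≐ (v ∷ τ) → σ ≐ τ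
∷-≐-cancel {v} v∉σ v∉τ (vσ⊆vτ , vτ⊆vσ) = cancel v∉σ vσ⊆vτ , cancel v∉τ vτ⊆vσ
  where
  cancel : ∀ {σ τ} → ¬ v ∈ σ → (v ∷ σ) ⊆ (v ∷ τ) → σ ⊆ τ
  cancel v∉σ vσ⊆vτ x x∈σ with vσ⊆vτ x (there x∈σ)
  ... | here refl = ⊥-elim (v∉σ x∈σ)
  ... | there x∈τ = x∈τ

1st : ∀ {a : ℤ} {xs} → a ∈ a ∷ xs
1st = here refl

2nd : ∀ {a b : ℤ} {xs} → b ∈ a ∷ b ∷ xs
2nd = there 1st

3rd : ∀ {a b c : ℤ} {xs} → c ∈ a ∷ b ∷ c ∷ xs
3rd = there 2nd

4th : ∀ {a b c d : ℤ} {xs} → d ∈ a ∷ b ∷ c ∷ d ∷ xs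
4th = there 3rd

there⁻² : ∀ {x a b : ℤ} {xs} → x ≢ a → x ≢ b → x ∈ a ∷ b ∷ xs → x ∈ xs
there⁻² x≢a _ (here x≡a) = ⊥-elim (x≢a x≡a)
there⁻² _ x≢b (there (here x≡b)) = ⊥-elim (x≢b x≡b)
there⁻² _ _ (there (there x∈xs)) = x∈xs

⊆-fromAll : ∀ {σ τ} → All (_∈ τ) σ → σ ⊆ τ
⊆-fromAll σ⊆τ _ = All.lookup σ⊆τ

≐-fromAll : ∀ {σ τ} → All (_∈ τ) σ → All (_∈ σ) τ → σ ≐ τ
≐-fromAll σ⊆τ τ⊆σ = ⊆-fromAll σ⊆τ , ⊆-fromAll τ⊆σ

≐-swap₄ : ∀ {a b c d : ℤ} → (a ∷ b ∷ c ∷ d ∷ []) ≐ (c ∷ d ∷ b ∷ a ∷ [])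
≐-swap₄ = ≐-fromAll (4th ∷ 3rd ∷ 1st ∷ 2nd ∷ []) (3rd ∷ 4th ∷ 2nd ∷ 1st ∷ [])

≐-reverse₄ : ∀ {a b c d : ℤ} → (a ∷ b ∷ c ∷ d ∷ []) ≐ (d ∷ c ∷ b ∷ a ∷ [])
≐-reverse₄ = ≐-fromAll (4th ∷ 3rd ∷ 2nd ∷ 1st ∷ []) (4th ∷ 3rd ∷ 2nd ∷ 1st ∷ [])

≐-distinguish : ∀ {x σ τ} → x ∈ σ → ¬ x ∈ τ → ¬ σ ≐ τ
≐-distinguish x∈σ x∉τ (σ⊆τ , _) = x∉τ (σ⊆τ _ x∈σ)

≐-distinguishʳ : ∀ {x σ τ} → x ∈ τ → ¬ x ∈ σ → ¬ σ ≐ τ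
≐-distinguishʳ x∈τ x∉σ = ≐-distinguish x∈τ x∉σ ∘ ≐-sym

FaceOf-⊆ : ∀ {Γ σ τ} → τ ⊆ σ → FaceOf Γ σ → FaceOf Γ τ
FaceOf-⊆ τ⊆σ = Any.map (⊆-trans τ⊆σ)

∈-removeV⁻ : ∀ {v x} G → x ∈ removeV v G → x ∈ G × x ≢ v
∈-removeV⁻ G x∈ with ∈-filter⁻ (T? ∘ λ y → not ⌊ y ℤ.≟ _ ⌋) {xs = G} x∈
... | x∈G , keep = x∈G , λ x≡v → T-not⇒¬T keep (fromWitness x≡v)

∈-removeV⁺ : ∀ {v x} G → x ∈ G → x ≢ v → x ∈ removeV v G
∈-removeV⁺ G x∈G x≢v = ∈-filter⁺ (T? ∘ λ y → not ⌊ y ℤ.≟ _ ⌋) x∈G (¬T⇒T-not (x≢v ∘ toWitness))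

removeV-⊆ : ∀ v G → removeV v G ⊆ G
removeV-⊆ v G x = proj₁ ∘ ∈-removeV⁻ G

length-removeV≤ : ∀ v ys → length (removeV v ys) ≤ length ys
length-removeV≤ v [] = z≤n
length-removeV≤ v (y ∷ ys) with y ℤ.≟ v
... | yes _ = ℕ.m≤n⇒m≤1+n (length-removeV≤ v ys)
... | no _ = s≤s (length-removeV≤ v ys)

length-removeV< : ∀ {v} ys → v ∈ ys → length (removeV v ys) < length ys
length-removeV< {v} (y ∷ ys) (here refl) with v ℤ.≟ v
... | yes _ = s≤s (length-removeV≤ v ys)
... | no v≢v = ⊥-elim (v≢v refl)
length-removeV< {v} (y ∷ ys) (there v∈ys) with y ℤ.≟ v
... | yes _ = ℕ.m≤n⇒m≤1+n (length-removeV< ys v∈ys)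
... | no _ = s≤s (length-removeV< ys v∈ys)

∈-─⁻ : ∀ {x v : ℤ} {L} → Unique L → (v∈L : v ∈ L) → x ∈ L ─ v∈L → x ∈ L × x ≢ v
∈-─⁻ (v∉L ∷ _) (here refl) x∈ = there x∈ , λ { refl → All.lookup v∉L x∈ refl }
∈-─⁻ (y∉L ∷ _) (there v∈L) (here refl) = here refl , λ { refl → All.lookup y∉L v∈L refl }
∈-─⁻ (_ ∷ L!) (there v∈L) (there x∈) with ∈-─⁻ L! v∈L x∈
... | x∈L , x≢v = there x∈L , x≢v

∈-─⁺ : ∀ {x v : ℤ} {L} → (v∈L : v ∈ L) → x ∈ L → x ≢ v → x ∈ L ─ v∈L
∈-─⁺ (here refl) (here refl) x≢v = ⊥-elim (x≢v refl)
∈-─⁺ (here refl) (there x∈) _ = x∈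
∈-─⁺ (there v∈L) (here refl) _ = here refl
∈-─⁺ (there v∈L) (there x∈) x≢v = there (∈-─⁺ v∈L x∈ x≢v)

removeV≐─ : ∀ {v L} → Unique L → (v∈L : v ∈ L) → removeV v L ≐ (L ─ v∈L)
removeV≐─ {L = L} L! v∈L = (λ x x∈ → let x∈L , x≢v = ∈-removeV⁻ L x∈ in ∈-─⁺ v∈L x∈L x≢v)
                         , (λ x x∈ → let x∈L , x≢v = ∈-─⁻ L! v∈L x∈ in ∈-removeV⁺ L x∈L x≢v)

HasSize : ℕ → Face → Set
HasSize n F = ∃[ L ] (Unique L × length L ≡ n × F ≐ L)

HasSize-resp-≐ : ∀ {n F G} → F ≐ G → HasSize n F → HasSize n G
HasSize-resp-≐ F≐G (L , L! , ∣L∣ , F≐L) = L , L! , ∣L∣ , ≐-trans (≐-sym F≐G) F≐L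

unique⊆⇒length≤ : ∀ xs ys → Unique xs → xs ⊆ ys → length xs ≤ length ys
unique⊆⇒length≤ [] ys [] _ = z≤n
unique⊆⇒length≤ (x ∷ xs) ys (x∉xs ∷ xs!) x∷xs⊆ys = ℕ.≤-trans
  (s≤s (unique⊆⇒length≤ xs (removeV x ys) xs!
    λ y y∈xs → ∈-removeV⁺ ys (x∷xs⊆ys y (there y∈xs)) λ y≡x → All.lookup x∉xs y∈xs (sym y≡x)))
  (length-removeV< ys (x∷xs⊆ys x (here refl)))

-- Pigeonhole: a vertex of G outside F would leave n vertices of F inside n − 1 vertices of G.
HasSize-⊆⇒⊇ : ∀ {n F G} → HasSize n F → HasSize n G → F ⊆ G → G ⊆ F
HasSize-⊆⇒⊇ {n} {F} (L , L! , refl , F≐L) (L′ , _ , ∣L′∣ , G≐L′) F⊆G y y∈G with y ∈? F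
... | yes y∈F = y∈F
... | no y∉F = ⊥-elim (ℕ.<⇒≱ lenRemoved< lenRemoved≥)
  where
  lenRemoved< : length (removeV y L′) < length L
  lenRemoved< = subst (length (removeV y L′) <_) ∣L′∣ (length-removeV< L′ (proj₁ G≐L′ y y∈G))
  lenRemoved≥ : length L ≤ length (removeV y L′)
  lenRemoved≥ = unique⊆⇒length≤ L (removeV y L′) L! λ z z∈L →
    ∈-removeV⁺ L′ (proj₁ G≐L′ z (F⊆G z (proj₂ F≐L z z∈L))) λ { refl → y∉F (proj₂ F≐L z z∈L) }

ridge-determines-generator : ∀ {n v F G H} → HasSize n G → HasSize n H → v ∈ G → F ≐ removeV v G → F ⊆ H → v ∈ H → H ≐ G
ridge-determines-generator {v = v} {G = G} G-size H-size v∈G F≐r F⊆H v∈H = HasSize-⊆⇒⊇ G-size H-size G⊆H , G⊆H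
  where
  G⊆H : G ⊆ _
  G⊆H x x∈G with x ℤ.≟ v
  ... | yes refl = v∈H
  ... | no x≢v = F⊆H x (proj₂ F≐r x (∈-removeV⁺ G x∈G x≢v))

Unique-─ : ∀ {v : ℤ} {L} → Unique L → (v∈L : v ∈ L) → Unique (L ─ v∈L)
Unique-─ (_ ∷ L!) (here refl) = L!
Unique-─ (y∉L ∷ L!) (there v∈L) = All.─⁺ v∈L y∉L ∷ Unique-─ L! v∈L

HasSize-─ : ∀ {v : ℤ} {L} → Unique L → (v∈L : v ∈ L) → HasSize (ℕ.pred (length L)) (L ─ v∈L)
HasSize-─ {L = L} L! v∈L = L ─ v∈L , Unique-─ L! v∈L , List.length-removeAt L (Any.index v∈L) , ≐-refl

Generator : Cx → Face → Set
Generator Γ F = Any (F ≐_) Γ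

Generator-resp-≐ : ∀ {Γ F F′} → F ≐ F′ → Generator Γ F → Generator Γ F′
Generator-resp-≐ F≐F′ = Any.map (≐-trans (≐-sym F≐F′))

Generator⇒FaceOf : ∀ {Γ F} → Generator Γ F → FaceOf Γ F
Generator⇒FaceOf = Any.map proj₁

FaceOf⇒⊆Generator : ∀ {Γ σ} → FaceOf Γ σ → ∃[ G ] (Generator Γ G × σ ⊆ G)
FaceOf⇒⊆Generator σ∈Γ with find σ∈Γ
... | G , G∈Γ , σ⊆G = G , lose G∈Γ ≐-refl , σ⊆G

IsFacet⇔Generator : ∀ {n Γ} → (∀ {G} → Generator Γ G → HasSize n G) → ∀ F → IsFacet Γ F ⇔ Generator Γ F
IsFacet⇔Generator {Γ = Γ} sized F = mk⇔ facet⇒generator generator⇒facet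
  where
  facet⇒generator : IsFacet Γ F → Generator Γ F
  facet⇒generator (F∈Γ , maximal) with FaceOf⇒⊆Generator F∈Γ
  ... | G , G-gen , F⊆G = Generator-resp-≐ (≐-sym (F⊆G , maximal G (Generator⇒FaceOf G-gen) F⊆G)) G-gen
  generator⇒facet : Generator Γ F → IsFacet Γ F
  generator⇒facet F-gen = Generator⇒FaceOf F-gen , below-facet
    where
    below-facet : ∀ τ → FaceOf Γ τ → F ⊆ τ → τ ⊆ F
    below-facet τ τ∈Γ F⊆τ with FaceOf⇒⊆Generator τ∈Γ
    ... | H , H-gen , τ⊆H = ⊆-trans τ⊆H (HasSize-⊆⇒⊇ (sized F-gen) (sized H-gen) (⊆-trans F⊆τ τ⊆H))

facets-characterised : ∀ {n Γ} (P : Face → Set) → (∀ F → Generator Γ F ⇔ P F) → (∀ {F} → P F → HasSize n F) →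
  ∀ F → IsFacet Γ F ⇔ P F
facets-characterised P gen⇔P sized F = ⇔-trans (IsFacet⇔Generator (sized ∘ Equivalence.to (gen⇔P _)) F) (gen⇔P F)

Generator-++⁻ : ∀ Γ {Δ F} → Generator (Γ ++ Δ) F → Generator Γ F ⊎ Generator Δ F
Generator-++⁻ Γ = Any.++⁻ Γ

Generator-++⁺ˡ : ∀ {Γ Δ F} → Generator Γ F → Generator (Γ ++ Δ) F
Generator-++⁺ˡ = Any.++⁺ˡ

Generator-++⁺ʳ : ∀ Γ {Δ F} → Generator Δ F → Generator (Γ ++ Δ) F
Generator-++⁺ʳ Γ = Any.++⁺ʳ Γ

Generator-join⁻ : ∀ v Γ {F} → Generator (join v Γ) F → ∃[ r ] (Generator Γ r × F ≐ (v ∷ r))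
Generator-join⁻ v Γ F-gen with find (Any.map⁻ F-gen)
... | r , r∈Γ , F≐v∷r = r , lose r∈Γ ≐-refl , F≐v∷r

Generator-join⁺ : ∀ v Γ {F r} → Generator Γ r → F ≐ (v ∷ r) → Generator (join v Γ) F
Generator-join⁺ v Γ r-gen F≐v∷r = Any.map⁺ (Any.map (λ r≐G → ≐-trans F≐v∷r (≐-∷⁺ r≐G)) r-gen)

neg-involutive : ∀ σ → neg (neg σ) ≡ σ
neg-involutive [] = refl
neg-involutive (x ∷ σ) = cong₂ _∷_ (ℤ.neg-involutive x) (neg-involutive σ)

negC-involutive : ∀ Γ → negC (negC Γ) ≡ Γ
negC-involutive [] = refl
negC-involutive (G ∷ Γ) = cong₂ _∷_ (neg-involutive G) (negC-involutive Γ)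

∈-neg⁺ : ∀ {x σ} → x ∈ σ → - x ∈ neg σ
∈-neg⁺ = ∈-map⁺ -_

∈-neg⁻ : ∀ {x σ} → x ∈ neg σ → - x ∈ σ
∈-neg⁻ x∈-σ with ∈-map⁻ -_ x∈-σ
... | y , y∈σ , refl = subst (_∈ _) (sym (ℤ.neg-involutive y)) y∈σ

neg-⊆ : ∀ {σ τ} → σ ⊆ τ → neg σ ⊆ neg τ
neg-⊆ σ⊆τ x x∈-σ = subst (_∈ neg _) (ℤ.neg-involutive x) (∈-neg⁺ (σ⊆τ _ (∈-neg⁻ x∈-σ)))

neg-≐ : ∀ {σ τ} → σ ≐ τ → neg σ ≐ neg τ
neg-≐ (σ⊆τ , τ⊆σ) = neg-⊆ σ⊆τ , neg-⊆ τ⊆σ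

neg-≐⁻ : ∀ {σ τ} → neg σ ≐ neg τ → σ ≐ τ
neg-≐⁻ {σ} {τ} -σ≐-τ = subst₂ _≐_ (neg-involutive σ) (neg-involutive τ) (neg-≐ -σ≐-τ)

≐-neg : ∀ {σ τ} → σ ≐ neg τ → neg σ ≐ τ
≐-neg {τ = τ} σ≐-τ = subst (_ ≐_) (neg-involutive τ) (neg-≐ σ≐-τ)

≐-neg⁻ : ∀ {σ τ} → neg σ ≐ τ → σ ≐ neg τ
≐-neg⁻ {σ} -σ≐τ = subst (_≐ _) (neg-involutive σ) (neg-≐ -σ≐τ)

HasSize-neg : ∀ {n F} → HasSize n F → HasSize n (neg F)
HasSize-neg (L , L! , ∣L∣ , F≐L) = neg L , AllPairs.map⁺ (AllPairs.map (λ x≢y → x≢y ∘ ℤ.neg-injective) L!) ,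
  trans (List.length-map -_ L) ∣L∣ , neg-≐ F≐L

Generator-negC⁻ : ∀ {Γ F} → Generator (negC Γ) F → Generator Γ (neg F)
Generator-negC⁻ = Any.map ≐-neg ∘ Any.map⁻

Generator-negC⁺ : ∀ {Γ F} → Generator Γ (neg F) → Generator (negC Γ) F
Generator-negC⁺ {F = F} = Any.map⁺ ∘ Any.map (λ -F≐G → subst (_≐ _) (neg-involutive F) (neg-≐ -F≐G))

pattern itself x = inj₁ x
pattern antipode x = inj₂ x

WithAntipodes-neg : ∀ {P F} → WithAntipodes P F → WithAntipodes P (neg F)
WithAntipodes-neg {P} {F} (itself PF) = antipode (subst P (sym (neg-involutive F)) PF)
WithAntipodes-neg (antipode P-F) = itself P-F

WithAntipodes-neg⁻ : ∀ {P F} → WithAntipodes P (neg F) → WithAntipodes P F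
WithAntipodes-neg⁻ {P} {F} = subst (WithAntipodes P) (neg-involutive F) ∘ WithAntipodes-neg {P} {neg F}

WithAntipodes-map : ∀ {P Q : Face → Set} → (∀ {G} → P G → Q G) → ∀ {F} → WithAntipodes P F → WithAntipodes Q F
WithAntipodes-map f (itself PF) = itself (f PF)
WithAntipodes-map f (antipode P-F) = antipode (f P-F)

HasSize-WithAntipodes : ∀ {n P} → (∀ {G} → P G → HasSize n G) → ∀ {F} → WithAntipodes P F → HasSize n F
HasSize-WithAntipodes sized (itself PF) = sized PF
HasSize-WithAntipodes {n} sized {F} (antipode P-F) = subst (HasSize n) (neg-involutive F) (HasSize-neg (sized P-F))

Generator-pm⁻ : ∀ Γ {F} → Generator (pm Γ) F → WithAntipodes (Generator Γ) F
Generator-pm⁻ Γ F-gen with Generator-++⁻ Γ F-gen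
... | inj₁ F∈Γ = itself F∈Γ
... | inj₂ F∈-Γ = antipode (Generator-negC⁻ F∈-Γ)

Generator-pm⁺ : ∀ Γ {F} → WithAntipodes (Generator Γ) F → Generator (pm Γ) F
Generator-pm⁺ Γ (itself F∈Γ) = Generator-++⁺ˡ F∈Γ
Generator-pm⁺ Γ (antipode -F∈Γ) = Generator-++⁺ʳ Γ (Generator-negC⁺ -F∈Γ)

Generator-∖⁻ : ∀ Δ Γ {F} → Generator (Δ ∖ Γ) F → Generator Δ F × ¬ FaceOf Γ F
Generator-∖⁻ Δ Γ F-gen with find F-gen
... | G , G∈Δ∖Γ , F≐G with ∈-filter⁻ (T? ∘ λ H → not (isFaceᵇ H Γ)) {xs = Δ} G∈Δ∖Γ
... | G∈Δ , G∉Γ = lose G∈Δ F≐G , λ F∈Γ → T-not⇒¬T G∉Γ (FaceOf⇒isFaceᵇ G Γ (FaceOf-⊆ (proj₂ F≐G) F∈Γ))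

Generator-∖⁺ : ∀ Δ Γ {F} → Generator Δ F → ¬ FaceOf Γ F → Generator (Δ ∖ Γ) F
Generator-∖⁺ Δ Γ F-gen F∉Γ with find F-gen
... | G , G∈Δ , F≐G = lose (∈-filter⁺ (T? ∘ λ H → not (isFaceᵇ H Γ)) G∈Δ
  (¬T⇒T-not λ G∈Γ → F∉Γ (FaceOf-⊆ (proj₁ F≐G) (isFaceᵇ⇒FaceOf G Γ G∈Γ)))) F≐G

Irredundant : Cx → Set
Irredundant = AllPairs (λ G H → ¬ G ≐ H)

Irredundant-negC : ∀ {B} → Irredundant B → Irredundant (negC B)
Irredundant-negC = AllPairs.map⁺ ∘ AllPairs.map (λ G≉H → G≉H ∘ neg-≐⁻)

Irredundant-++ : ∀ {Γ Δ} → Irredundant Γ → Irredundant Δ → (∀ {G H} → G ∈ Γ → H ∈ Δ → ¬ G ≐ H) → Irredundant (Γ ++ Δ)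
Irredundant-++ Γ! Δ! Γ≉Δ = AllPairs.++⁺ Γ! Δ! (All.tabulate λ G∈Γ → All.tabulate (Γ≉Δ G∈Γ))

Irredundant-map-∷ : ∀ {v Γ} → All (λ σ → ¬ v ∈ σ) Γ → Irredundant Γ → Irredundant (map (v ∷_) Γ)
Irredundant-map-∷ [] [] = []
Irredundant-map-∷ (v∉σ ∷ v∉Γ) (σ≉Γ ∷ Γ!) =
  All.map⁺ (All.zipWith (λ (σ≉τ , v∉τ) → σ≉τ ∘ ∷-≐-cancel v∉σ v∉τ) (σ≉Γ , v∉Γ))
  ∷ Irredundant-map-∷ v∉Γ Γ!

count : Face → Cx → ℕ
count r B = length (filterᵇ (r ⊆ᵇ_) B)

∈-length≡1 : ∀ {A : Set} {x y : A} xs → length xs ≡ 1 → x ∈ xs → y ∈ xs → x ≡ y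
∈-length≡1 (_ ∷ []) _ (here refl) (here refl) = refl
∈-length≡1 (_ ∷ []) _ (here _) (there ())
∈-length≡1 (_ ∷ []) _ (there ()) _

count≡1⇒unique : ∀ r B {H H′} → count r B ≡ 1 → H ∈ B → H′ ∈ B → r ⊆ H → r ⊆ H′ → H ≡ H′
count≡1⇒unique r B c H∈B H′∈B r⊆H r⊆H′ = ∈-length≡1 (filterᵇ (r ⊆ᵇ_) B) c
  (∈-filter⁺ (T? ∘ (r ⊆ᵇ_)) H∈B (⊆⇒⊆ᵇ r _ r⊆H)) (∈-filter⁺ (T? ∘ (r ⊆ᵇ_)) H′∈B (⊆⇒⊆ᵇ r _ r⊆H′))

unique⇒count≡1 : ∀ r B {G} → Irredundant B → G ∈ B → r ⊆ G → (∀ H → H ∈ B → r ⊆ H → H ≐ G) → count r B ≡ 1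
unique⇒count≡1 r (X ∷ B) (X≉B ∷ _) (here refl) r⊆X uniq =
  cong length (trans (List.filter-accept (T? ∘ (r ⊆ᵇ_)) (⊆⇒⊆ᵇ r X r⊆X))
                     (cong (X ∷_) (List.filter-none (T? ∘ (r ⊆ᵇ_)) (All.tabulate outside))))
  where
  outside : ∀ {H} → H ∈ B → ¬ T (r ⊆ᵇ H)
  outside {H} H∈B r⊆H = All.lookup X≉B H∈B (≐-sym (uniq H (there H∈B) (⊆ᵇ⇒⊆ r H r⊆H)))
unique⇒count≡1 r (X ∷ B) (X≉B ∷ B!) (there G∈B) r⊆G uniq =
  trans (cong length (List.filter-reject (T? ∘ (r ⊆ᵇ_)) X∌r))
        (unique⇒count≡1 r B B! G∈B r⊆G (λ H → uniq H ∘ there))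
  where
  X∌r : ¬ T (r ⊆ᵇ X)
  X∌r r⊆X = All.lookup X≉B G∈B (uniq X (here refl) (⊆ᵇ⇒⊆ r X r⊆X))

BoundaryRidge : Cx → Face → Set
BoundaryRidge B F = ∃[ G ] ∃[ v ] (G ∈ B × v ∈ G × F ≐ removeV v G × (∀ H → H ∈ B → F ⊆ H → H ≐ G))

Generator-∂⁻ : ∀ B {F} → Generator (∂ B) F → BoundaryRidge B F
Generator-∂⁻ B F-gen with find F-gen
... | r , r∈∂B , F≐r with ∈-filter⁻ (T? ∘ λ r → ⌊ count r B ℕ.≟ 1 ⌋) {xs = ridges B} r∈∂B
... | r∈ridges , single with find (∈-concatMap⁻ (λ G → map (λ v → removeV v G) G) {xs = B} r∈ridges)
... | G , G∈B , r∈ridgesG with ∈-map⁻ (λ v → removeV v G) r∈ridgesG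
... | v , v∈G , refl = G , v , G∈B , v∈G , F≐r , λ H H∈B F⊆H →
  subst (_≐ G) (count≡1⇒unique r B (toWitness single) G∈B H∈B (removeV-⊆ v G) (⊆-trans (proj₂ F≐r) F⊆H)) ≐-refl

Generator-∂⁺ : ∀ B {F} → Irredundant B → BoundaryRidge B F → Generator (∂ B) F
Generator-∂⁺ B B! (G , v , G∈B , v∈G , F≐r , uniq) =
  lose (∈-filter⁺ (T? ∘ λ r → ⌊ count r B ℕ.≟ 1 ⌋) r∈ridges
         (fromWitness (unique⇒count≡1 r B B! G∈B (removeV-⊆ v G) λ H H∈B r⊆H → uniq H H∈B (⊆-trans (proj₁ F≐r) r⊆H))))
       F≐r
  where
  r : Face
  r = removeV v G
  r∈ridges : r ∈ ridges B
  r∈ridges = ∈-concatMap⁺ (λ G → map (λ v → removeV v G) G) (lose G∈B (∈-map⁺ (λ v → removeV v G) v∈G))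

removeV-neg : ∀ v G → removeV v (neg G) ≐ neg (removeV (- v) G)
removeV-neg v G = (λ _ → to ∘ ∈-removeV⁻ (neg G)) , (λ _ → from ∘ ∈-removeV⁻ G ∘ ∈-neg⁻)
  where
  to : ∀ {x} → x ∈ neg G × x ≢ v → x ∈ neg (removeV (- v) G)
  to {x} (x∈-G , x≢v) = subst (_∈ _) (ℤ.neg-involutive x)
    (∈-neg⁺ (∈-removeV⁺ G (∈-neg⁻ x∈-G) (x≢v ∘ ℤ.neg-injective)))
  from : ∀ {x} → - x ∈ G × - x ≢ - v → x ∈ removeV v (neg G)
  from {x} (-x∈G , -x≢-v) = ∈-removeV⁺ (neg G) (subst (_∈ _) (ℤ.neg-involutive x) (∈-neg⁺ -x∈G)) (-x≢-v ∘ cong -_)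

BoundaryRidge-negC⁻ : ∀ B {F} → BoundaryRidge (negC B) F → BoundaryRidge B (neg F)
BoundaryRidge-negC⁻ B {F} (G′ , v , G′∈-B , v∈G′ , F≐r , uniq) with ∈-map⁻ neg G′∈-B
... | G , G∈B , refl = G , - v , G∈B , ∈-neg⁻ v∈G′ , ≐-neg (≐-trans F≐r (removeV-neg v G)) , λ H H∈B -F⊆H →
  neg-≐⁻ (uniq (neg H) (∈-map⁺ neg H∈B) (subst (_⊆ neg H) (neg-involutive F) (neg-⊆ -F⊆H)))

BoundaryRidge-negC⁺ : ∀ B {F} → BoundaryRidge B (neg F) → BoundaryRidge (negC B) F
BoundaryRidge-negC⁺ B {F} ridge = subst (BoundaryRidge (negC B)) (neg-involutive F)
  (BoundaryRidge-negC⁻ (negC B) (subst (λ Γ → BoundaryRidge Γ (neg F)) (sym (negC-involutive B)) ridge))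

Generator-∂-negC⁻ : ∀ B {F} → Irredundant B → Generator (∂ (negC B)) F → Generator (∂ B) (neg F)
Generator-∂-negC⁻ B B! = Generator-∂⁺ B B! ∘ BoundaryRidge-negC⁻ B ∘ Generator-∂⁻ (negC B)

Generator-∂-negC⁺ : ∀ B {F} → Irredundant B → Generator (∂ B) (neg F) → Generator (∂ (negC B)) F
Generator-∂-negC⁺ B B! = Generator-∂⁺ (negC B) (Irredundant-negC B!) ∘ BoundaryRidge-negC⁺ B ∘ Generator-∂⁻ B

_⊑ᵇ_ : Cx → Cx → Bool
Γ ⊑ᵇ Δ = all (λ G → any (λ H → (G ⊆ᵇ H) ∧ (H ⊆ᵇ G)) Δ) Γ

⊑ᵇ-sound : ∀ Γ Δ → T (Γ ⊑ᵇ Δ) → ∀ {F} → Generator Γ F → Generator Δ F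
⊑ᵇ-sound Γ Δ Γ⊑Δ F-gen =
  let G , G∈Γ , F≐G = find F-gen
  in Any.map (λ {H} G≐ᵇH → let G⊆H , H⊆G = Equivalence.to T-∧ G≐ᵇH in ≐-trans F≐G (⊆ᵇ⇒⊆ G H G⊆H , ⊆ᵇ⇒⊆ H G H⊆G))
             (Any.any⁻ _ Δ (All.lookup (All.all⁺ _ Γ Γ⊑Δ) G∈Γ))

disjointᵇ : Cx → Cx → Bool
disjointᵇ Γ Δ = all (λ G → all (λ H → not (G ⊆ᵇ H)) Δ) Γ

disjointᵇ-sound : ∀ Γ Δ → T (disjointᵇ Γ Δ) → ∀ {F} → Generator Γ F → ¬ Generator Δ F
disjointᵇ-sound Γ Δ Γ∦Δ F∈Γ F∈Δ =
  let G , G∈Γ , F≐G = find F∈Γ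
      H , H∈Δ , F≐H = find F∈Δ
  in T-not⇒¬T (All.lookup (All.all⁺ _ Δ (All.lookup (All.all⁺ _ Γ Γ∦Δ) G∈Γ)) H∈Δ)
       (⊆⇒⊆ᵇ G H (⊆-trans (proj₂ F≐G) (proj₁ F≐H)))

p≢p : ∀ {a b} → a ≢ b → p a ≢ p b
p≢p a≢b = a≢b ∘ ℤ.+-injective

m≢m : ∀ {a b} → a ≢ b → m a ≢ m b
m≢m a≢b = a≢b ∘ ℤ.+-injective ∘ ℤ.neg-injective

p≢m : ∀ {a b} → 1 ≤ a → p a ≢ m b
p≢m {suc a} {zero} _ ()
p≢m {suc a} {suc b} _ ()

m≢p : ∀ {a b} → 1 ≤ a → m a ≢ p b
m≢p {suc a} _ ()

∉-fromAll : ∀ {x : ℤ} {σ} → All (x ≢_) σ → ¬ x ∈ σ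
∉-fromAll = All.All¬⇒¬Any

Bounded : ℕ → Face → Set
Bounded b F = ∀ x → x ∈ F → ∣ x ∣ ≤ b

Bounded-∌ : ∀ {b F x} → Bounded b F → b < ∣ x ∣ → ¬ x ∈ F
Bounded-∌ bounded b<∣x∣ x∈F = ℕ.<⇒≱ b<∣x∣ (bounded _ x∈F)

Bounded-fromAll : ∀ {b F} → All (λ x → ∣ x ∣ ≤ b) F → Bounded b F
Bounded-fromAll bounded _ = All.lookup bounded

Bounded-⊆ : ∀ {b F G} → F ⊆ G → Bounded b G → Bounded b F
Bounded-⊆ F⊆G bounded x = bounded x ∘ F⊆G x

Bounded-mono : ∀ {b c F} → b ≤ c → Bounded b F → Bounded c F
Bounded-mono b≤c bounded x = λ x∈F → ℕ.≤-trans (bounded x x∈F) b≤c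

Bounded-neg : ∀ {b F} → Bounded b F → Bounded b (neg F)
Bounded-neg bounded x x∈-F = subst (ℕ._≤ _) (ℤ.∣-i∣≡∣i∣ x) (bounded _ (∈-neg⁻ x∈-F))

Bounded-WithAntipodes : ∀ {b P} → (∀ {G} → P G → Bounded b G) → ∀ {F} → WithAntipodes P F → Bounded b F
Bounded-WithAntipodes bounded (itself PF) = bounded PF
Bounded-WithAntipodes {b} bounded {F} (antipode P-F) = subst (Bounded b) (neg-involutive F) (Bounded-neg (bounded P-F))

pathEdges-++ : ∀ xs y ys → pathEdges (xs ++ y ∷ ys) ≡ pathEdges (xs ++ [ y ]) ++ pathEdges (y ∷ ys)
pathEdges-++ [] y ys = refl
pathEdges-++ (x ∷ []) y ys = refl
pathEdges-++ (x ∷ x′ ∷ xs) y ys = cong ((x ∷ x′ ∷ []) ∷_) (pathEdges-++ (x′ ∷ xs) y ys)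

pathEdges-applyUpTo-∷ʳ : ∀ (f : ℕ → ℤ) n y →
  pathEdges (applyUpTo f (suc n) ++ [ y ]) ≡ pathEdges (applyUpTo f (suc n)) ++ [ f n ∷ y ∷ [] ]
pathEdges-applyUpTo-∷ʳ f n y = begin
    pathEdges (applyUpTo f (suc n) ++ [ y ])
  ≡⟨ cong (λ xs → pathEdges (xs ++ [ y ])) (sym (List.applyUpTo-∷ʳ f n)) ⟩
    pathEdges ((applyUpTo f n ++ [ f n ]) ++ [ y ])
  ≡⟨ cong pathEdges (List.++-assoc (applyUpTo f n) [ f n ] [ y ]) ⟩
    pathEdges (applyUpTo f n ++ f n ∷ y ∷ [])
  ≡⟨ pathEdges-++ (applyUpTo f n) (f n) (y ∷ []) ⟩
    pathEdges (applyUpTo f n ++ [ f n ]) ++ [ f n ∷ y ∷ [] ]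
  ≡⟨ cong (λ xs → pathEdges xs ++ [ f n ∷ y ∷ [] ]) (List.applyUpTo-∷ʳ f n) ⟩
    pathEdges (applyUpTo f (suc n)) ++ [ f n ∷ y ∷ [] ]
  ∎
  where open ≡-Reasoning

∈-pathEdges-applyUpTo⁻ : ∀ (f : ℕ → ℤ) n {e} → e ∈ pathEdges (applyUpTo f n) →
  ∃[ j ] (suc j < n × e ≡ f j ∷ f (suc j) ∷ [])
∈-pathEdges-applyUpTo⁻ f (suc (suc n)) (here refl) = 0 , s≤s (s≤s z≤n) , refl
∈-pathEdges-applyUpTo⁻ f (suc (suc n)) (there e∈) with ∈-pathEdges-applyUpTo⁻ (f ∘ suc) (suc n) e∈
... | j , j+1<n , refl = suc j , s≤s j+1<n , refl

∈-pathEdges-applyUpTo⁺ : ∀ (f : ℕ → ℤ) n j → suc j < n → (f j ∷ f (suc j) ∷ []) ∈ pathEdges (applyUpTo f n)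
∈-pathEdges-applyUpTo⁺ f (suc zero) zero (s≤s ())
∈-pathEdges-applyUpTo⁺ f (suc (suc n)) zero _ = here refl
∈-pathEdges-applyUpTo⁺ f (suc (suc n)) (suc j) (s≤s j+1<n) = there (∈-pathEdges-applyUpTo⁺ (f ∘ suc) (suc n) j j+1<n)

Irredundant-pathEdges-applyUpTo : ∀ (f : ℕ → ℤ) n → (∀ {i j} → f i ≡ f j → i ≡ j) → Irredundant (pathEdges (applyUpTo f n))
Irredundant-pathEdges-applyUpTo f zero _ = []
Irredundant-pathEdges-applyUpTo f (suc zero) _ = []
Irredundant-pathEdges-applyUpTo f (suc (suc n)) f-inj =
  All.tabulate first-edge-not-later ∷ Irredundant-pathEdges-applyUpTo (f ∘ suc) (suc n) (ℕ.suc-injective ∘ f-inj)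
  where
  first-edge-not-later : ∀ {e} → e ∈ pathEdges (applyUpTo (f ∘ suc) (suc n)) → ¬ (f 0 ∷ f 1 ∷ []) ≐ e
  first-edge-not-later e∈ with ∈-pathEdges-applyUpTo⁻ (f ∘ suc) (suc n) e∈
  ... | j , _ , refl = ≐-distinguish (here refl) (∉-fromAll ((λ f0≡ → case f-inj f0≡ of λ ()) ∷ (λ f0≡ → case f-inj f0≡ of λ ()) ∷ []))

-- The path B^{1,1}_K, K = 2 + k

module Path (k : ℕ) where

  K : ℕ
  K = 2 + k

  data Edge : Face → Set where
    ascending  : ∀ {i} → 1 ≤ i → i ≤ suc k → Edge (p i ∷ p (suc i) ∷ [])
    descending : ∀ {i} → 1 ≤ i → i ≤ suc k → Edge (m i ∷ m (suc i) ∷ [])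
    closing    : Edge (m K ∷ p 1 ∷ [])

  private
    ups downs : List ℤ
    ups = applyUpTo (p ∘ suc) K
    downs = applyUpTo (m ∘ suc) K

    upper lower : Cx
    upper = pathEdges ups ++ [ p K ∷ m 1 ∷ [] ]
    lower = pathEdges downs ++ [ m K ∷ p 1 ∷ [] ]

  Δ1-halves : Δ1 K ≡ upper ++ lower
  Δ1-halves = begin
      pathEdges ((ups ++ downs) ++ [ p 1 ])
    ≡⟨ cong pathEdges (List.++-assoc ups downs [ p 1 ]) ⟩
      pathEdges (ups ++ m 1 ∷ (applyUpTo (m ∘ suc ∘ suc) (suc k) ++ [ p 1 ]))
    ≡⟨ pathEdges-++ ups (m 1) _ ⟩
      pathEdges (ups ++ [ m 1 ]) ++ pathEdges (downs ++ [ p 1 ])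
    ≡⟨ cong₂ _++_ (pathEdges-applyUpTo-∷ʳ (p ∘ suc) (suc k) (m 1)) (pathEdges-applyUpTo-∷ʳ (m ∘ suc) (suc k) (p 1)) ⟩
      upper ++ lower
    ∎
    where open ≡-Reasoning

  AscendingPair DescendingPair : Face → Set
  AscendingPair e = ∃[ i ] (1 ≤ i × i ≤ suc k × e ≡ p i ∷ p (suc i) ∷ [])
  DescendingPair e = ∃[ i ] (1 ≤ i × i ≤ suc k × e ≡ m i ∷ m (suc i) ∷ [])

  ∈-upper⁻ : ∀ {e} → e ∈ upper → AscendingPair e ⊎ e ≡ p K ∷ m 1 ∷ []
  ∈-upper⁻ e∈ with ∈-++⁻ (pathEdges ups) e∈
  ... | inj₂ (here refl) = inj₂ refl
  ... | inj₁ e∈path with ∈-pathEdges-applyUpTo⁻ (p ∘ suc) K e∈path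
  ... | j , s≤s j<K , refl = inj₁ (suc j , s≤s z≤n , j<K , refl)

  ∈-lower⁻ : ∀ {e} → e ∈ lower → DescendingPair e ⊎ e ≡ m K ∷ p 1 ∷ []
  ∈-lower⁻ e∈ with ∈-++⁻ (pathEdges downs) e∈
  ... | inj₂ (here refl) = inj₂ refl
  ... | inj₁ e∈path with ∈-pathEdges-applyUpTo⁻ (m ∘ suc) K e∈path
  ... | j , s≤s j<K , refl = inj₁ (suc j , s≤s z≤n , j<K , refl)

  ∈-Δ1⁺ : ∀ {e} → Edge e → e ∈ Δ1 K
  ∈-Δ1⁺ {e} edge = subst (e ∈_) (sym Δ1-halves) (∈-halves edge)
    where
    ∈-halves : ∀ {e} → Edge e → e ∈ upper ++ lower
    ∈-halves (ascending {suc j} _ j<K) = ∈-++⁺ˡ (∈-++⁺ˡ (∈-pathEdges-applyUpTo⁺ (p ∘ suc) K j (s≤s j<K)))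
    ∈-halves (descending {suc j} _ j<K) = ∈-++⁺ʳ upper (∈-++⁺ˡ (∈-pathEdges-applyUpTo⁺ (m ∘ suc) K j (s≤s j<K)))
    ∈-halves closing = ∈-++⁺ʳ upper (∈-++⁺ʳ (pathEdges downs) (here refl))

  removed-edge : Face
  removed-edge = p K ∷ m 1 ∷ []

  Edge-∉B10 : ∀ {e} → Edge e → ¬ FaceOf (B10 K) e
  Edge-∉B10 (ascending {i} 1≤i i≤k+1) (here e⊆) =
    ∉-fromAll (p≢m 1≤i ∷ p≢p (ℕ.<⇒≢ (s≤s i≤k+1)) ∷ []) (e⊆ _ (here refl))
  Edge-∉B10 (descending {suc i} (s≤s z≤n) _) (here e⊆) =
    ∉-fromAll (m≢m (λ ()) ∷ m≢p (s≤s z≤n) ∷ []) (e⊆ _ (there (here refl)))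
  Edge-∉B10 closing (here e⊆) = ∉-fromAll ((λ ()) ∷ (λ ()) ∷ []) (e⊆ _ (there (here refl)))

  ∈-B11⁻ : ∀ {e} → e ∈ B11 K → Edge e
  ∈-B11⁻ {e} e∈ with ∈-filter⁻ (T? ∘ λ F → not (isFaceᵇ F (B10 K))) {xs = Δ1 K} e∈
  ... | e∈Δ1 , kept with ∈-++⁻ upper (subst (e ∈_) Δ1-halves e∈Δ1)
  ... | inj₂ e∈lower with ∈-lower⁻ e∈lower
  ...   | inj₁ (i , 1≤i , i≤k+1 , refl) = descending 1≤i i≤k+1
  ...   | inj₂ refl = closing
  ∈-B11⁻ {e} e∈ | e∈Δ1 , kept | inj₁ e∈upper with ∈-upper⁻ e∈upper
  ...   | inj₁ (i , 1≤i , i≤k+1 , refl) = ascending 1≤i i≤k+1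
  ...   | inj₂ refl = ⊥-elim (T-not⇒¬T kept (FaceOf⇒isFaceᵇ removed-edge (B10 K)
                        (here (⊆-fromAll (there (here refl) ∷ here refl ∷ [])))))

  ∈-B11⁺ : ∀ {e} → Edge e → e ∈ B11 K
  ∈-B11⁺ {e} edge = ∈-filter⁺ (T? ∘ λ F → not (isFaceᵇ F (B10 K))) (∈-Δ1⁺ edge)
    (¬T⇒T-not (Edge-∉B10 edge ∘ isFaceᵇ⇒FaceOf e (B10 K)))

  Irredundant-B11 : Irredundant (B11 K)
  Irredundant-B11 = AllPairs.filter⁺ (T? ∘ λ F → not (isFaceᵇ F (B10 K)))
    (subst Irredundant (sym Δ1-halves) (Irredundant-++
      (Irredundant-++ (Irredundant-pathEdges-applyUpTo (p ∘ suc) K (ℕ.suc-injective ∘ ℤ.+-injective)) ([] ∷ []) path-vs-removed)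
      (Irredundant-++ (Irredundant-pathEdges-applyUpTo (m ∘ suc) K (ℕ.suc-injective ∘ ℤ.+-injective ∘ ℤ.neg-injective)) ([] ∷ []) path-vs-closing)
      upper-vs-lower))
    where
    path-vs-removed : ∀ {G H} → G ∈ pathEdges ups → H ∈ [ removed-edge ] → ¬ G ≐ H
    path-vs-removed G∈ (here refl) with ∈-pathEdges-applyUpTo⁻ (p ∘ suc) K G∈
    ... | j , _ , refl = ≐-distinguishʳ (there (here refl)) (∉-fromAll ((λ ()) ∷ (λ ()) ∷ []))
    path-vs-closing : ∀ {G H} → G ∈ pathEdges downs → H ∈ [ m K ∷ p 1 ∷ [] ] → ¬ G ≐ H
    path-vs-closing G∈ (here refl) with ∈-pathEdges-applyUpTo⁻ (m ∘ suc) K G∈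
    ... | j , _ , refl = ≐-distinguishʳ (there (here refl)) (∉-fromAll ((λ ()) ∷ (λ ()) ∷ []))
    upper-vs-lower : ∀ {G H} → G ∈ upper → H ∈ lower → ¬ G ≐ H
    upper-vs-lower G∈ H∈ with ∈-upper⁻ G∈ | ∈-lower⁻ H∈
    ... | inj₁ (i , 1≤i , _ , refl) | inj₁ (_ , _ , _ , refl) =
      ≐-distinguish (here refl) (∉-fromAll (p≢m 1≤i ∷ p≢m 1≤i ∷ []))
    ... | inj₁ (suc i , _ , _ , refl) | inj₂ refl =
      ≐-distinguish (there (here refl)) (∉-fromAll ((λ ()) ∷ p≢p (λ ()) ∷ []))
    ... | inj₂ refl | inj₁ (_ , _ , _ , refl) = ≐-distinguish (here refl) (∉-fromAll (p≢m (s≤s z≤n) ∷ p≢m (s≤s z≤n) ∷ []))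
    ... | inj₂ refl | inj₂ refl = ≐-distinguish (here refl) (∉-fromAll ((λ ()) ∷ (λ ()) ∷ []))

-- The ball B^{3,1}_N, N = 4 + k, and its boundary

module Ball (k : ℕ) where
  open Path k public

  N N-1 : ℕ
  N = 4 + k
  N-1 = 3 + k

  data Facet : Face → Set where
    edge-facet : ∀ {e} → Edge e → Facet (p N ∷ p N-1 ∷ e)
    facet⁺     : Facet (p N ∷ m N-1 ∷ p 1 ∷ m K ∷ [])
    facet⁻     : Facet (m N ∷ m N-1 ∷ p 1 ∷ m K ∷ [])

  K<N-1 : K < N-1
  K<N-1 = ℕ.≤-refl

  K<N : K < N
  K<N = ℕ.m≤n⇒m≤1+n K<N-1

  ∈-B31⁻ : ∀ {H} → H ∈ B31 N → Facet H
  ∈-B31⁻ H∈ with ∈-++⁻ (map (p N ∷_) (B21 N-1)) H∈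
  ... | inj₂ (here refl) = facet⁻
  ... | inj₁ H∈N*B21 with ∈-map⁻ (p N ∷_) H∈N*B21
  ... | X , X∈B21 , refl with ∈-++⁻ (map (p N-1 ∷_) (B11 K)) X∈B21
  ...   | inj₂ (here refl) = facet⁺
  ...   | inj₁ X∈ with ∈-map⁻ (p N-1 ∷_) X∈
  ...     | e , e∈B11 , refl = edge-facet (∈-B11⁻ e∈B11)

  ∈-B31⁺ : ∀ {H} → Facet H → H ∈ B31 N
  ∈-B31⁺ (edge-facet edge) = ∈-++⁺ˡ (∈-map⁺ (p N ∷_) (∈-++⁺ˡ (∈-map⁺ (p N-1 ∷_) (∈-B11⁺ edge))))
  ∈-B31⁺ facet⁺ = ∈-++⁺ˡ (∈-map⁺ (p N ∷_) (∈-++⁺ʳ (map (p N-1 ∷_) (B11 K)) (here refl)))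
  ∈-B31⁺ facet⁻ = ∈-++⁺ʳ (map (p N ∷_) (B21 N-1)) (here refl)

  Edge-Bounded : ∀ {e} → Edge e → Bounded K e
  Edge-Bounded (ascending _ i≤k+1) = Bounded-fromAll (ℕ.m≤n⇒m≤1+n i≤k+1 ∷ s≤s i≤k+1 ∷ [])
  Edge-Bounded (descending {suc _} _ i≤k+1) = Bounded-fromAll (ℕ.m≤n⇒m≤1+n i≤k+1 ∷ s≤s i≤k+1 ∷ [])
  Edge-Bounded closing = Bounded-fromAll (ℕ.≤-refl ∷ s≤s z≤n ∷ [])

  Edge-∌ : ∀ {e x} → Edge e → K < ∣ x ∣ → ¬ x ∈ e
  Edge-∌ = Bounded-∌ ∘ Edge-Bounded

  Edge-distinct : ∀ {a b} → Edge (a ∷ b ∷ []) → a ≢ b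
  Edge-distinct (ascending _ _) = p≢p (ℕ.<⇒≢ ℕ.≤-refl)
  Edge-distinct (descending _ _) = m≢m (ℕ.<⇒≢ ℕ.≤-refl)
  Edge-distinct closing = λ ()

  edge-vertices : ∀ {e} → Edge e → ∃[ a ] ∃[ b ] (e ≡ a ∷ b ∷ [])
  edge-vertices (ascending _ _) = _ , _ , refl
  edge-vertices (descending _ _) = _ , _ , refl
  edge-vertices closing = _ , _ , refl

  Facet-Unique : ∀ {H} → Facet H → Unique H
  Facet-Unique (edge-facet {e} edge) with edge-vertices edge
  ... | a , b , refl = ((λ ()) ∷ above (here refl) K<N ∷ above (there (here refl)) K<N ∷ [])
                     ∷ (above (here refl) K<N-1 ∷ above (there (here refl)) K<N-1 ∷ [])
                     ∷ (Edge-distinct edge ∷ []) ∷ [] ∷ []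
    where
    above : ∀ {x y} → x ∈ e → K < y → p y ≢ x
    above x∈e K<y refl = Edge-∌ edge K<y x∈e
  Facet-Unique facet⁺ = ((λ ()) ∷ (λ ()) ∷ (λ ()) ∷ []) ∷ ((λ ()) ∷ m≢m (λ ()) ∷ []) ∷ ((λ ()) ∷ []) ∷ [] ∷ []
  Facet-Unique facet⁻ = (m≢m (λ ()) ∷ (λ ()) ∷ m≢m (λ ()) ∷ []) ∷ ((λ ()) ∷ m≢m (λ ()) ∷ []) ∷ ((λ ()) ∷ []) ∷ [] ∷ []

  Facet-length : ∀ {H} → Facet H → length H ≡ 4
  Facet-length (edge-facet edge) with edge-vertices edge
  ... | _ , _ , refl = refl
  Facet-length facet⁺ = refl
  Facet-length facet⁻ = refl

  Facet-HasSize : ∀ {H} → Facet H → HasSize 4 H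
  Facet-HasSize {H} facet = H , Facet-Unique facet , Facet-length facet , ≐-refl

  Facet-∋p[N-1] : ∀ {H} → Facet H → p N-1 ∈ H → ∃[ e ] (Edge e × H ≡ p N ∷ p N-1 ∷ e)
  Facet-∋p[N-1] (edge-facet edge) _ = _ , edge , refl
  Facet-∋p[N-1] facet⁺ N-1∈ = ⊥-elim (∉-fromAll ((λ ()) ∷ (λ ()) ∷ (λ ()) ∷ (λ ()) ∷ []) N-1∈)
  Facet-∋p[N-1] facet⁻ N-1∈ = ⊥-elim (∉-fromAll ((λ ()) ∷ (λ ()) ∷ (λ ()) ∷ (λ ()) ∷ []) N-1∈)

  Facet-∋m[N-1] : ∀ {H} → Facet H → m N-1 ∈ H → H ≡ p N ∷ m N-1 ∷ p 1 ∷ m K ∷ [] ⊎ H ≡ m N ∷ m N-1 ∷ p 1 ∷ m K ∷ []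
  Facet-∋m[N-1] (edge-facet edge) (there (there N-1∈e)) = ⊥-elim (Edge-∌ edge K<N-1 N-1∈e)
  Facet-∋m[N-1] facet⁺ _ = inj₁ refl
  Facet-∋m[N-1] facet⁻ _ = inj₂ refl

  Facet-∋mN : ∀ {H} → Facet H → m N ∈ H → H ≡ m N ∷ m N-1 ∷ p 1 ∷ m K ∷ []
  Facet-∋mN (edge-facet edge) (there (there N∈e)) = ⊥-elim (Edge-∌ edge K<N N∈e)
  Facet-∋mN facet⁺ N∈ = ⊥-elim (∉-fromAll ((λ ()) ∷ m≢m (λ ()) ∷ (λ ()) ∷ m≢m (λ ()) ∷ []) N∈)
  Facet-∋mN facet⁻ _ = refl

  Irredundant-B31 : Irredundant (B31 N)
  Irredundant-B31 = Irredundant-++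
    (Irredundant-map-∷ (All.tabulate N∉B21)
      (Irredundant-++ (Irredundant-map-∷ (All.tabulate λ e∈ → Edge-∌ (∈-B11⁻ e∈) K<N-1) Irredundant-B11) ([] ∷ [])
        λ G∈ → λ { (here refl) → ≐-distinguish (p[N-1]∈ G∈) (∉-fromAll ((λ ()) ∷ (λ ()) ∷ (λ ()) ∷ [])) }))
    ([] ∷ [])
    λ G∈ → λ { (here refl) → ≐-distinguish (pN∈ G∈) (∉-fromAll ((λ ()) ∷ (λ ()) ∷ (λ ()) ∷ (λ ()) ∷ [])) }
    where
    p[N-1]∈ : ∀ {G} → G ∈ map (p N-1 ∷_) (B11 K) → p N-1 ∈ G
    p[N-1]∈ G∈ with ∈-map⁻ (p N-1 ∷_) G∈
    ... | _ , _ , refl = here refl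
    pN∈ : ∀ {G} → G ∈ map (p N ∷_) (B21 N-1) → p N ∈ G
    pN∈ G∈ with ∈-map⁻ (p N ∷_) G∈
    ... | _ , _ , refl = here refl
    N∉B21 : ∀ {σ} → σ ∈ B21 N-1 → ¬ p N ∈ σ
    N∉B21 σ∈ with ∈-++⁻ (map (p N-1 ∷_) (B11 K)) σ∈
    ... | inj₂ (here refl) = ∉-fromAll ((λ ()) ∷ (λ ()) ∷ (λ ()) ∷ [])
    ... | inj₁ σ∈′ with ∈-map⁻ (p N-1 ∷_) σ∈′
    ...   | e , e∈ , refl = ∉-fromAll ((λ ()) ∷ All.tabulate λ x∈e → λ { refl → Edge-∌ (∈-B11⁻ e∈) K<N x∈e })

  small≢pN : ∀ {a} → a ≤ K → p a ≢ p N
  small≢pN a≤K = p≢p (ℕ.<⇒≢ (ℕ.m≤n⇒m≤1+n (s≤s a≤K)))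

  small≢pN-1 : ∀ {a} → a ≤ K → p a ≢ p N-1
  small≢pN-1 a≤K = p≢p (ℕ.<⇒≢ (s≤s a≤K))

  small≢mN : ∀ {a} → a ≤ K → m a ≢ m N
  small≢mN a≤K = m≢m (ℕ.<⇒≢ (ℕ.m≤n⇒m≤1+n (s≤s a≤K)))

  small≢mN-1 : ∀ {a} → a ≤ K → m a ≢ m N-1
  small≢mN-1 a≤K = m≢m (ℕ.<⇒≢ (s≤s a≤K))

  data Triangle : Face → Set where
    edge∪N-1      : ∀ {e} → Edge e → Triangle (p N-1 ∷ e)
    N∪ascending   : ∀ {i} → 1 ≤ i → i ≤ suc k → Triangle (p N ∷ p i ∷ p (suc i) ∷ [])
    N∪descending  : ∀ {i} → 1 ≤ i → i ≤ suc k → Triangle (p N ∷ m i ∷ m (suc i) ∷ [])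
    N∪N-1∪K       : Triangle (p N ∷ p N-1 ∷ p K ∷ [])
    N∪N-1∪-1      : Triangle (p N ∷ p N-1 ∷ m 1 ∷ [])
    N∪-N-1∪1      : Triangle (p N ∷ m N-1 ∷ p 1 ∷ [])
    N∪-N-1∪-K     : Triangle (p N ∷ m N-1 ∷ m K ∷ [])
    -N∪-N-1∪1     : Triangle (m N ∷ m N-1 ∷ p 1 ∷ [])
    -N∪-N-1∪-K    : Triangle (m N ∷ m N-1 ∷ m K ∷ [])
    -N∪1∪-K       : Triangle (m N ∷ p 1 ∷ m K ∷ [])

  BoundaryFace : Face → Set
  BoundaryFace F = ∃[ t ] (Triangle t × F ≐ t)

  SoleFacet : Face → Face → Set
  SoleFacet G F = ∀ {H} → Facet H → F ⊆ H → H ≐ G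

  shared : ∀ {A : Set} {F G H x} → SoleFacet G F → Facet H → F ⊆ H → x ∈ H → ¬ x ∈ G → A
  shared sole H F⊆H x∈H x∉G = ⊥-elim (≐-distinguish x∈H x∉G (sole H F⊆H))

  boundary-of-ascending : ∀ {i F v} (1≤i : 1 ≤ i) (i≤k+1 : i ≤ suc k) → let G = p N ∷ p N-1 ∷ p i ∷ p (suc i) ∷ [] in
    (v∈G : v ∈ G) → F ≐ (G ─ v∈G) → SoleFacet G F → BoundaryFace F
  boundary-of-ascending 1≤i i≤k+1 (here refl) F≐ _ = _ , edge∪N-1 (ascending 1≤i i≤k+1) , F≐
  boundary-of-ascending 1≤i i≤k+1 (there (here refl)) F≐ _ = _ , N∪ascending 1≤i i≤k+1 , F≐
  boundary-of-ascending {i} 1≤i i≤k+1 (there (there (here refl))) F≐ sole with ℕ.m≤n⇒m<n∨m≡n i≤k+1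
  ... | inj₂ refl = _ , N∪N-1∪K , F≐
  ... | inj₁ (s≤s i≤k) = shared sole (edge-facet (ascending (s≤s z≤n) (s≤s i≤k)))
    (⊆-trans (proj₁ F≐) (⊆-fromAll (1st ∷ 2nd ∷ 3rd ∷ []))) 4th
    (∉-fromAll (small≢pN i+2≤K ∷ small≢pN-1 i+2≤K ∷ p≢p (ℕ.>⇒≢ (ℕ.m<n⇒m<1+n ℕ.≤-refl)) ∷ p≢p (ℕ.>⇒≢ ℕ.≤-refl) ∷ []))
    where
    i+2≤K : suc (suc i) ≤ K
    i+2≤K = s≤s (s≤s i≤k)
  boundary-of-ascending {suc zero} _ _ (there (there (there (here refl)))) F≐ sole =
    shared sole (edge-facet closing) (⊆-trans (proj₁ F≐) (⊆-fromAll (1st ∷ 2nd ∷ 4th ∷ []))) 3rd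
      (∉-fromAll ((λ ()) ∷ (λ ()) ∷ (λ ()) ∷ (λ ()) ∷ []))
  boundary-of-ascending {suc (suc i)} _ i≤k+1 (there (there (there (here refl)))) F≐ sole =
    shared sole (edge-facet (ascending (s≤s z≤n) (ℕ.m≤n⇒m≤1+n (ℕ.≤-pred i≤k+1))))
      (⊆-trans (proj₁ F≐) (⊆-fromAll (1st ∷ 2nd ∷ 4th ∷ []))) 3rd
      (∉-fromAll (small≢pN i+1≤K ∷ small≢pN-1 i+1≤K ∷ p≢p (ℕ.<⇒≢ ℕ.≤-refl) ∷ p≢p (ℕ.<⇒≢ (ℕ.m<n⇒m<1+n ℕ.≤-refl)) ∷ []))
    where
    i+1≤K : suc i ≤ K
    i+1≤K = ℕ.m≤n⇒m≤1+n (ℕ.m≤n⇒m≤1+n (ℕ.≤-pred i≤k+1))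

  boundary-of-descending : ∀ {i F v} (1≤i : 1 ≤ i) (i≤k+1 : i ≤ suc k) → let G = p N ∷ p N-1 ∷ m i ∷ m (suc i) ∷ [] in
    (v∈G : v ∈ G) → F ≐ (G ─ v∈G) → SoleFacet G F → BoundaryFace F
  boundary-of-descending 1≤i i≤k+1 (here refl) F≐ _ = _ , edge∪N-1 (descending 1≤i i≤k+1) , F≐
  boundary-of-descending 1≤i i≤k+1 (there (here refl)) F≐ _ = _ , N∪descending 1≤i i≤k+1 , F≐
  boundary-of-descending {i} 1≤i i≤k+1 (there (there (here refl))) F≐ sole with ℕ.m≤n⇒m<n∨m≡n i≤k+1
  ... | inj₂ refl = shared sole (edge-facet closing) (⊆-trans (proj₁ F≐) (⊆-fromAll (1st ∷ 2nd ∷ 3rd ∷ []))) 4th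
    (∉-fromAll ((λ ()) ∷ (λ ()) ∷ (λ ()) ∷ (λ ()) ∷ []))
  ... | inj₁ (s≤s i≤k) = shared sole (edge-facet (descending (s≤s z≤n) (s≤s i≤k)))
    (⊆-trans (proj₁ F≐) (⊆-fromAll (1st ∷ 2nd ∷ 3rd ∷ []))) 4th
    (∉-fromAll ((λ ()) ∷ (λ ()) ∷ m≢m (ℕ.>⇒≢ (ℕ.m<n⇒m<1+n ℕ.≤-refl)) ∷ m≢m (ℕ.>⇒≢ ℕ.≤-refl) ∷ []))
  boundary-of-descending {suc zero} _ _ (there (there (there (here refl)))) F≐ _ = _ , N∪N-1∪-1 , F≐
  boundary-of-descending {suc (suc i)} _ i≤k+1 (there (there (there (here refl)))) F≐ sole =
    shared sole (edge-facet (descending (s≤s z≤n) (ℕ.m≤n⇒m≤1+n (ℕ.≤-pred i≤k+1))))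
      (⊆-trans (proj₁ F≐) (⊆-fromAll (1st ∷ 2nd ∷ 4th ∷ []))) 3rd
      (∉-fromAll ((λ ()) ∷ (λ ()) ∷ m≢m (ℕ.<⇒≢ ℕ.≤-refl) ∷ m≢m (ℕ.<⇒≢ (ℕ.m<n⇒m<1+n ℕ.≤-refl)) ∷ []))

  boundary-of-closing : ∀ {F v} → let G = p N ∷ p N-1 ∷ m K ∷ p 1 ∷ [] in
    (v∈G : v ∈ G) → F ≐ (G ─ v∈G) → SoleFacet G F → BoundaryFace F
  boundary-of-closing (here refl) F≐ _ = _ , edge∪N-1 closing , F≐
  boundary-of-closing (there (here refl)) F≐ sole =
    shared sole facet⁺ (⊆-trans (proj₁ F≐) (⊆-fromAll (1st ∷ 4th ∷ 3rd ∷ []))) 2nd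
      (∉-fromAll ((λ ()) ∷ (λ ()) ∷ m≢m (λ ()) ∷ (λ ()) ∷ []))
  boundary-of-closing (there (there (here refl))) F≐ sole =
    shared sole (edge-facet (ascending (s≤s z≤n) (s≤s z≤n))) (⊆-trans (proj₁ F≐) (⊆-fromAll (1st ∷ 2nd ∷ 3rd ∷ []))) 4th
      (∉-fromAll ((λ ()) ∷ (λ ()) ∷ (λ ()) ∷ (λ ()) ∷ []))
  boundary-of-closing (there (there (there (here refl)))) F≐ sole =
    shared sole (edge-facet (descending (s≤s z≤n) ℕ.≤-refl)) (⊆-trans (proj₁ F≐) (⊆-fromAll (1st ∷ 2nd ∷ 4th ∷ []))) 3rd
      (∉-fromAll ((λ ()) ∷ (λ ()) ∷ m≢m (λ ()) ∷ (λ ()) ∷ []))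

  boundary-of-facet⁺ : ∀ {F v} → let G = p N ∷ m N-1 ∷ p 1 ∷ m K ∷ [] in
    (v∈G : v ∈ G) → F ≐ (G ─ v∈G) → SoleFacet G F → BoundaryFace F
  boundary-of-facet⁺ (here refl) F≐ sole =
    shared sole facet⁻ (⊆-trans (proj₁ F≐) (⊆-fromAll (2nd ∷ 3rd ∷ 4th ∷ []))) 1st
      (∉-fromAll ((λ ()) ∷ m≢m (λ ()) ∷ (λ ()) ∷ m≢m (λ ()) ∷ []))
  boundary-of-facet⁺ (there (here refl)) F≐ sole =
    shared sole (edge-facet closing) (⊆-trans (proj₁ F≐) (⊆-fromAll (1st ∷ 4th ∷ 3rd ∷ []))) 2nd
      (∉-fromAll ((λ ()) ∷ (λ ()) ∷ (λ ()) ∷ (λ ()) ∷ []))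
  boundary-of-facet⁺ (there (there (here refl))) F≐ _ = _ , N∪-N-1∪-K , F≐
  boundary-of-facet⁺ (there (there (there (here refl)))) F≐ _ = _ , N∪-N-1∪1 , F≐

  boundary-of-facet⁻ : ∀ {F v} → let G = m N ∷ m N-1 ∷ p 1 ∷ m K ∷ [] in
    (v∈G : v ∈ G) → F ≐ (G ─ v∈G) → SoleFacet G F → BoundaryFace F
  boundary-of-facet⁻ (here refl) F≐ sole =
    shared sole facet⁺ (⊆-trans (proj₁ F≐) (⊆-fromAll (2nd ∷ 3rd ∷ 4th ∷ []))) 1st
      (∉-fromAll ((λ ()) ∷ (λ ()) ∷ (λ ()) ∷ (λ ()) ∷ []))
  boundary-of-facet⁻ (there (here refl)) F≐ _ = _ , -N∪1∪-K , F≐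
  boundary-of-facet⁻ (there (there (here refl))) F≐ _ = _ , -N∪-N-1∪-K , F≐
  boundary-of-facet⁻ (there (there (there (here refl)))) F≐ _ = _ , -N∪-N-1∪1 , F≐

  Generator-∂B31⁻ : ∀ {F} → Generator (∂ (B31 N)) F → BoundaryFace F
  Generator-∂B31⁻ F-gen with Generator-∂⁻ (B31 N) F-gen
  ... | G , v , G∈B , v∈G , F≐r , uniq = boundary-of (∈-B31⁻ G∈B) v∈G
    (≐-trans F≐r (removeV≐─ (Facet-Unique (∈-B31⁻ G∈B)) v∈G)) (λ H → uniq _ (∈-B31⁺ H))
    where
    boundary-of : ∀ {G F v} → Facet G → (v∈G : v ∈ G) → F ≐ (G ─ v∈G) → SoleFacet G F → BoundaryFace F
    boundary-of (edge-facet (ascending 1≤i i≤k+1)) = boundary-of-ascending 1≤i i≤k+1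
    boundary-of (edge-facet (descending 1≤i i≤k+1)) = boundary-of-descending 1≤i i≤k+1
    boundary-of (edge-facet closing) = boundary-of-closing
    boundary-of facet⁺ = boundary-of-facet⁺
    boundary-of facet⁻ = boundary-of-facet⁻

  boundary-ridge : ∀ {G v} → Facet G → (v∈G : v ∈ G) → (∀ {H} → Facet H → (G ─ v∈G) ⊆ H → v ∈ H) →
    BoundaryRidge (B31 N) (G ─ v∈G)
  boundary-ridge {G} {v} facet v∈G apex = G , v , ∈-B31⁺ facet , v∈G , ridge≐ , λ H H∈B r⊆H →
    ridge-determines-generator (Facet-HasSize facet) (Facet-HasSize (∈-B31⁻ H∈B)) v∈G ridge≐ r⊆H (apex (∈-B31⁻ H∈B) r⊆H)
    where
    ridge≐ : (G ─ v∈G) ≐ removeV v G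
    ridge≐ = ≐-sym (removeV≐─ (Facet-Unique facet) v∈G)

  Edge-∋pK : ∀ {e} → Edge e → p K ∈ e → p (suc k) ∈ e
  Edge-∋pK (ascending _ i≤k+1) (here K≡i) = ⊥-elim (ℕ.<⇒≢ (s≤s i≤k+1) (sym (ℤ.+-injective K≡i)))
  Edge-∋pK (ascending _ _) (there (here K≡i+1)) with ℤ.+-injective K≡i+1
  ... | refl = 1st
  Edge-∋pK (descending {suc _} _ _) (here ())
  Edge-∋pK (descending {suc _} _ _) (there (here ()))
  Edge-∋pK closing (there (here ()))

  Edge-∋m1 : ∀ {e} → Edge e → m 1 ∈ e → m 2 ∈ e
  Edge-∋m1 (ascending _ _) (here ())
  Edge-∋m1 (ascending _ _) (there (here ()))
  Edge-∋m1 closing (here ())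
  Edge-∋m1 closing (there (here ()))
  Edge-∋m1 (descending {suc zero} _ _) _ = 2nd
  Edge-∋m1 (descending {suc (suc i)} _ _) (here ())
  Edge-∋m1 (descending {suc (suc i)} _ _) (there (here ()))

  ∋-facet⁺ : ∀ {H} → Facet H → p N ∈ H → m N-1 ∈ H → H ≡ p N ∷ m N-1 ∷ p 1 ∷ m K ∷ []
  ∋-facet⁺ H N∈H -N-1∈H with Facet-∋m[N-1] H -N-1∈H
  ... | inj₁ H≡ = H≡
  ∋-facet⁺ facet⁻ N∈H _ | inj₂ refl = ⊥-elim (∉-fromAll ((λ ()) ∷ (λ ()) ∷ (λ ()) ∷ (λ ()) ∷ []) N∈H)

  Triangle-BoundaryRidge : ∀ {t} → Triangle t → BoundaryRidge (B31 N) t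
  Triangle-BoundaryRidge (edge∪N-1 edge) = boundary-ridge (edge-facet edge) 1st λ H t⊆H →
    case Facet-∋p[N-1] H (t⊆H _ 1st) of λ { (_ , _ , refl) → 1st }
  Triangle-BoundaryRidge (N∪ascending {suc i} 1≤i i≤k+1) = boundary-ridge (edge-facet (ascending 1≤i i≤k+1)) 2nd apex
    where
    apex : ∀ {H} → Facet H → (p N ∷ p (suc i) ∷ p (suc (suc i)) ∷ []) ⊆ H → p N-1 ∈ H
    apex (edge-facet _) _ = 2nd
    apex facet⁺ t⊆H = ⊥-elim (∉-fromAll (small≢pN (s≤s i≤k+1) ∷ (λ ()) ∷ (λ ()) ∷ (λ ()) ∷ []) (t⊆H _ 3rd))
    apex facet⁻ t⊆H = ⊥-elim (∉-fromAll ((λ ()) ∷ (λ ()) ∷ (λ ()) ∷ (λ ()) ∷ []) (t⊆H _ 1st))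
  Triangle-BoundaryRidge (N∪descending {suc i} 1≤i i≤k+1) = boundary-ridge (edge-facet (descending 1≤i i≤k+1)) 2nd apex
    where
    apex : ∀ {H} → Facet H → (p N ∷ m (suc i) ∷ m (suc (suc i)) ∷ []) ⊆ H → p N-1 ∈ H
    apex (edge-facet _) _ = 2nd
    apex facet⁺ t⊆H = ⊥-elim (∉-fromAll ((λ ()) ∷ small≢mN-1 (ℕ.m≤n⇒m≤1+n i≤k+1) ∷ (λ ()) ∷ m≢m (ℕ.<⇒≢ (s≤s i≤k+1)) ∷ []) (t⊆H _ 2nd))
    apex facet⁻ t⊆H = ⊥-elim (∉-fromAll ((λ ()) ∷ (λ ()) ∷ (λ ()) ∷ (λ ()) ∷ []) (t⊆H _ 1st))
  Triangle-BoundaryRidge N∪N-1∪K = boundary-ridge (edge-facet (ascending (s≤s z≤n) ℕ.≤-refl)) 3rd λ H t⊆H →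
    case Facet-∋p[N-1] H (t⊆H _ 2nd) of λ { (_ , edge , refl) → there (there (Edge-∋pK edge (there⁻² (small≢pN ℕ.≤-refl) (small≢pN-1 ℕ.≤-refl) (t⊆H _ 3rd)))) }
  Triangle-BoundaryRidge N∪N-1∪-1 = boundary-ridge (edge-facet (descending (s≤s z≤n) (s≤s z≤n))) 4th λ H t⊆H →
    case Facet-∋p[N-1] H (t⊆H _ 2nd) of λ { (_ , edge , refl) → there (there (Edge-∋m1 edge (there⁻² (λ ()) (λ ()) (t⊆H _ 3rd)))) }
  Triangle-BoundaryRidge N∪-N-1∪1 = boundary-ridge facet⁺ 4th λ H t⊆H →
    subst (m K ∈_) (sym (∋-facet⁺ H (t⊆H _ 1st) (t⊆H _ 2nd))) 4th
  Triangle-BoundaryRidge N∪-N-1∪-K = boundary-ridge facet⁺ 3rd λ H t⊆H →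
    subst (p 1 ∈_) (sym (∋-facet⁺ H (t⊆H _ 1st) (t⊆H _ 2nd))) 3rd
  Triangle-BoundaryRidge -N∪-N-1∪1 = boundary-ridge facet⁻ 4th λ H t⊆H →
    subst (m K ∈_) (sym (Facet-∋mN H (t⊆H _ 1st))) 4th
  Triangle-BoundaryRidge -N∪-N-1∪-K = boundary-ridge facet⁻ 3rd λ H t⊆H →
    subst (p 1 ∈_) (sym (Facet-∋mN H (t⊆H _ 1st))) 3rd
  Triangle-BoundaryRidge -N∪1∪-K = boundary-ridge facet⁻ 2nd λ H t⊆H →
    subst (m N-1 ∈_) (sym (Facet-∋mN H (t⊆H _ 1st))) 2nd

  Generator-∂B31⁺ : ∀ {F} → BoundaryFace F → Generator (∂ (B31 N)) F
  Generator-∂B31⁺ (t , triangle , F≐t) =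
    Generator-resp-≐ (≐-sym F≐t) (Generator-∂⁺ (B31 N) Irredundant-B31 (Triangle-BoundaryRidge triangle))

  Facet-Bounded : ∀ {G} → Facet G → Bounded N G
  Facet-Bounded (edge-facet edge) =
    Bounded-fromAll (ℕ.≤-refl ∷ ℕ.n≤1+n N-1 ∷ All.tabulate λ x∈e → ℕ.≤-trans (Edge-Bounded edge _ x∈e) (ℕ.<⇒≤ K<N))
  Facet-Bounded facet⁺ = Bounded-fromAll (ℕ.≤-refl ∷ ℕ.n≤1+n N-1 ∷ s≤s z≤n ∷ ℕ.<⇒≤ K<N ∷ [])
  Facet-Bounded facet⁻ = Bounded-fromAll (ℕ.≤-refl ∷ ℕ.n≤1+n N-1 ∷ s≤s z≤n ∷ ℕ.<⇒≤ K<N ∷ [])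

  Triangle-HasSize : ∀ {t} → Triangle t → HasSize 3 t
  Triangle-HasSize triangle with Triangle-BoundaryRidge triangle
  ... | G , v , G∈B , v∈G , t≐r , _ = HasSize-resp-≐ (≐-sym (≐-trans t≐r (removeV≐─ G! v∈G)))
    (subst (λ n → HasSize n (G ─ v∈G)) (cong ℕ.pred (Facet-length (∈-B31⁻ G∈B))) (HasSize-─ G! v∈G))
    where
    G! : Unique G
    G! = Facet-Unique (∈-B31⁻ G∈B)

  Triangle-Bounded : ∀ {t} → Triangle t → Bounded N t
  Triangle-Bounded triangle with Triangle-BoundaryRidge triangle
  ... | G , v , G∈B , v∈G , t≐r , _ =
    Bounded-⊆ (⊆-trans (proj₁ t≐r) (removeV-⊆ v G)) (Facet-Bounded (∈-B31⁻ G∈B))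

pattern ascending₁ i 1≤i i≤ F≐ = inj₁ (i , 1≤i , i≤ , F≐)
pattern descending₁ i 1≤i i≤ F≐ = inj₂ (inj₁ (i , 1≤i , i≤ , F≐))
pattern closing₁ F≐ = inj₂ (inj₂ (inj₁ F≐))
pattern positive₁ F≐ = inj₂ (inj₂ (inj₂ (inj₁ F≐)))
pattern negative₁ F≐ = inj₂ (inj₂ (inj₂ (inj₂ F≐)))

pattern ascending₂ i ℓ 1≤i i+1<ℓ ℓ≤ F≐ = inj₁ (i , ℓ , 1≤i , i+1<ℓ , ℓ≤ , F≐)
pattern descending₂ i ℓ 1≤i i+1<ℓ ℓ≤ F≐ = inj₂ (inj₁ (i , ℓ , 1≤i , i+1<ℓ , ℓ≤ , F≐))
pattern closing₂ i ℓ 1≤i i+1<ℓ ℓ≤ F≐ = inj₂ (inj₂ (inj₁ (i , ℓ , 1≤i , i+1<ℓ , ℓ≤ , F≐)))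
pattern top₂ ℓ 2≤ℓ ℓ≤ F≐ = inj₂ (inj₂ (inj₂ (inj₁ (ℓ , 2≤ℓ , ℓ≤ , F≐))))
pattern wrap₂ ℓ 2≤ℓ ℓ≤ F≐ = inj₂ (inj₂ (inj₂ (inj₂ (ℓ , 2≤ℓ , ℓ≤ , F≐))))

pattern fam1 x = inj₁ x
pattern fam2 x = inj₂ (inj₁ x)
pattern fam3 x = inj₂ (inj₂ x)

+1≡suc : ∀ i → i + 1 ≡ suc i
+1≡suc i = ℕ.+-comm i 1

module Facets (k : ℕ) where
  open Ball k public

  Fam1⇒Generator : ∀ {F} → Fam1 N F → Generator (B31 N) F
  Fam1⇒Generator {F} (ascending₁ i 1≤i i≤k+1 F≐) = lose (∈-B31⁺ (edge-facet (ascending 1≤i i≤k+1)))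
    (≐-trans (subst (λ j → F ≐ (p i ∷ p j ∷ p N-1 ∷ p N ∷ [])) (+1≡suc i) F≐) (≐-sym ≐-swap₄))
  Fam1⇒Generator {F} (descending₁ i 1≤i i≤k+1 F≐) = lose (∈-B31⁺ (edge-facet (descending 1≤i i≤k+1)))
    (≐-trans (subst (λ j → F ≐ (m i ∷ m j ∷ p N-1 ∷ p N ∷ [])) (+1≡suc i) F≐) (≐-sym ≐-swap₄))
  Fam1⇒Generator (closing₁ F≐) = lose (∈-B31⁺ (edge-facet closing)) (≐-trans F≐ ≐-reverse₄)
  Fam1⇒Generator (positive₁ F≐) = lose (∈-B31⁺ facet⁺) (≐-trans F≐ (≐-sym ≐-swap₄))
  Fam1⇒Generator (negative₁ F≐) = lose (∈-B31⁺ facet⁻) (≐-trans F≐ (≐-sym ≐-swap₄))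

  Facet⇒Fam1 : ∀ {H F} → Facet H → F ≐ H → Fam1 N F
  Facet⇒Fam1 {F = F} (edge-facet (ascending {i} 1≤i i≤k+1)) F≐H = ascending₁ i 1≤i i≤k+1
    (subst (λ j → F ≐ (p i ∷ p j ∷ p N-1 ∷ p N ∷ [])) (sym (+1≡suc i)) (≐-trans F≐H ≐-swap₄))
  Facet⇒Fam1 {F = F} (edge-facet (descending {i} 1≤i i≤k+1)) F≐H = descending₁ i 1≤i i≤k+1
    (subst (λ j → F ≐ (m i ∷ m j ∷ p N-1 ∷ p N ∷ [])) (sym (+1≡suc i)) (≐-trans F≐H ≐-swap₄))
  Facet⇒Fam1 (edge-facet closing) F≐H = closing₁ (≐-trans F≐H ≐-reverse₄)
  Facet⇒Fam1 facet⁺ F≐H = positive₁ (≐-trans F≐H ≐-swap₄)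
  Facet⇒Fam1 facet⁻ F≐H = negative₁ (≐-trans F≐H ≐-swap₄)

  Generator⇒Fam1 : ∀ {F} → Generator (B31 N) F → Fam1 N F
  Generator⇒Fam1 F-gen = let H , H∈B , F≐H = find F-gen in Facet⇒Fam1 (∈-B31⁻ H∈B) F≐H

  Fam1-HasSize : ∀ {F} → Fam1 N F → HasSize 4 F
  Fam1-HasSize F∈ = let H , H∈B , F≐H = find (Fam1⇒Generator F∈) in HasSize-resp-≐ (≐-sym F≐H) (Facet-HasSize (∈-B31⁻ H∈B))

  Generator-±B31⁻ : ∀ {F} → Generator (pm (B31 N)) F → WithAntipodes (Fam1 N) F
  Generator-±B31⁻ {F} F-gen = WithAntipodes-map {P = Generator (B31 N)} {Q = Fam1 N} Generator⇒Fam1 {F} (Generator-pm⁻ (B31 N) F-gen)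

  Generator-±B31⁺ : ∀ {F} → WithAntipodes (Fam1 N) F → Generator (pm (B31 N)) F
  Generator-±B31⁺ {F} F∈ = Generator-pm⁺ (B31 N) (WithAntipodes-map {P = Fam1 N} {Q = Generator (B31 N)} Fam1⇒Generator {F} F∈)

  FaceOf-±B31 : ∀ {F} → HasSize 4 F → FaceOf (pm (B31 N)) F → WithAntipodes (Fam1 N) F
  FaceOf-±B31 {F} F-size F∈ =
    let G , G-gen , F⊆G = FaceOf⇒⊆Generator {Γ = pm (B31 N)} F∈
        G-size = HasSize-WithAntipodes Fam1-HasSize (Generator-±B31⁻ G-gen)
    in Generator-±B31⁻ (Generator-resp-≐ (≐-sym (F⊆G , HasSize-⊆⇒⊇ F-size G-size F⊆G)) G-gen)

-- Cones over the boundary of B^{3,1}_N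

module Step (k : ℕ) where
  open Facets k public

  M : ℕ
  M = 5 + k

  Cone : Face → Set
  Cone F = ∃[ t ] (Triangle t × F ≐ (p M ∷ t))

  Generator-cone⁻ : ∀ {F} → Generator (join (p M) (∂ (B31 N))) F → Cone F
  Generator-cone⁻ F-gen =
    let r , r-gen , F≐Mr = Generator-join⁻ (p M) (∂ (B31 N)) F-gen
        t , triangle , r≐t = Generator-∂B31⁻ r-gen
    in t , triangle , ≐-trans F≐Mr (≐-∷⁺ r≐t)

  Generator-cone⁺ : ∀ {F} → Cone F → Generator (join (p M) (∂ (B31 N))) F
  Generator-cone⁺ (t , triangle , F≐Mt) = Generator-join⁺ (p M) (∂ (B31 N)) (Generator-∂B31⁺ (t , triangle , ≐-refl)) F≐Mt

  Generator-antipodal-cone⁻ : ∀ {F} → Generator (join (m M) (∂ (negC (B31 N)))) F → Cone (neg F)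
  Generator-antipodal-cone⁻ F-gen =
    let r , r-gen , F≐-Mr = Generator-join⁻ (m M) (∂ (negC (B31 N))) F-gen
        t , triangle , -r≐t = Generator-∂B31⁻ (Generator-∂-negC⁻ (B31 N) Irredundant-B31 r-gen)
    in t , triangle , ≐-trans (neg-≐ F≐-Mr) (≐-∷⁺ -r≐t)

  Generator-antipodal-cone⁺ : ∀ {F} → Cone (neg F) → Generator (join (m M) (∂ (negC (B31 N)))) F
  Generator-antipodal-cone⁺ (t , triangle , -F≐Mt) =
    Generator-join⁺ (m M) (∂ (negC (B31 N))) (Generator-∂-negC⁺ (B31 N) Irredundant-B31
                      (Generator-∂B31⁺ (t , triangle , subst (_≐ t) (sym (neg-involutive t)) ≐-refl)))
                    (≐-neg⁻ -F≐Mt)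

  Cone-HasSize : ∀ {F} → Cone F → HasSize 4 F
  Cone-HasSize (t , triangle , F≐Mt) with Triangle-HasSize triangle
  ... | L , L! , ∣L∣ , t≐L = p M ∷ L , All.tabulate M∉L ∷ L! , cong suc ∣L∣ , ≐-trans F≐Mt (≐-∷⁺ t≐L)
    where
    M∉L : ∀ {x} → x ∈ L → p M ≢ x
    M∉L x∈L refl = Bounded-∌ (Triangle-Bounded triangle) ℕ.≤-refl (proj₂ t≐L _ x∈L)

  Cone-Bounded : ∀ {F} → Cone F → Bounded M F
  Cone-Bounded (t , triangle , F≐Mt) = Bounded-⊆ (proj₁ F≐Mt)
    (Bounded-fromAll (ℕ.≤-refl ∷ All.tabulate λ x∈t → ℕ.m≤n⇒m≤1+n (Triangle-Bounded triangle _ x∈t)))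

  -- the members of (2) for M with ℓ = N − 1 (first three kinds) or ℓ = K (last two kinds)
  data New : Face → Set where
    new-ascending  : ∀ {i} → 1 ≤ i → i ≤ suc k → New (p i ∷ p (suc i) ∷ p N-1 ∷ p M ∷ [])
    new-descending : ∀ {i} → 1 ≤ i → i ≤ suc k → New (m i ∷ m (suc i) ∷ p N-1 ∷ p M ∷ [])
    new-closing    : New (p 1 ∷ m K ∷ p N-1 ∷ p M ∷ [])
    new-top        : New (p K ∷ p N-1 ∷ p N ∷ m M ∷ [])
    new-wrap       : New (m 1 ∷ p K ∷ p N ∷ m M ∷ [])

  NewFace : Face → Set
  NewFace F = ∃[ L ] (New L × F ≐ L)

  Cone⇒ : ∀ {F} → Cone F → WithAntipodes (Fam1 M) F ⊎ WithAntipodes NewFace F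
  Cone⇒ (_ , edge∪N-1 (ascending 1≤i i≤k+1) , F≐) = inj₂ (itself (_ , new-ascending 1≤i i≤k+1 , ≐-trans F≐ ≐-swap₄))
  Cone⇒ (_ , edge∪N-1 (descending 1≤i i≤k+1) , F≐) = inj₂ (itself (_ , new-descending 1≤i i≤k+1 , ≐-trans F≐ ≐-swap₄))
  Cone⇒ (_ , edge∪N-1 closing , F≐) = inj₂ (itself (_ , new-closing , ≐-trans F≐ ≐-reverse₄))
  Cone⇒ {F} (_ , N∪ascending {i} 1≤i i≤k+1 , F≐) = inj₁ (itself (ascending₁ i 1≤i (ℕ.m≤n⇒m≤1+n i≤k+1)
    (subst (λ j → F ≐ (p i ∷ p j ∷ p N ∷ p M ∷ [])) (sym (+1≡suc i)) (≐-trans F≐ ≐-swap₄))))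
  Cone⇒ {F} (_ , N∪descending {i} 1≤i i≤k+1 , F≐) = inj₁ (itself (descending₁ i 1≤i (ℕ.m≤n⇒m≤1+n i≤k+1)
    (subst (λ j → F ≐ (m i ∷ m j ∷ p N ∷ p M ∷ [])) (sym (+1≡suc i)) (≐-trans F≐ ≐-swap₄))))
  Cone⇒ {F} (_ , N∪N-1∪K , F≐) = inj₁ (itself (ascending₁ K (s≤s z≤n) ℕ.≤-refl
    (subst (λ j → F ≐ (p K ∷ p j ∷ p N ∷ p M ∷ [])) (sym (+1≡suc K)) (≐-trans F≐ ≐-reverse₄))))
  Cone⇒ (_ , N∪N-1∪-1 , F≐) = inj₁ (antipode (negative₁ (≐-trans (neg-≐ F≐) ≐-reverse₄)))
  Cone⇒ (_ , N∪-N-1∪1 , F≐) = inj₁ (itself (closing₁ (≐-trans F≐ ≐-reverse₄)))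
  Cone⇒ {F} (_ , N∪-N-1∪-K , F≐) = inj₁ (itself (descending₁ K (s≤s z≤n) ℕ.≤-refl
    (subst (λ j → F ≐ (m K ∷ m j ∷ p N ∷ p M ∷ [])) (sym (+1≡suc K)) (≐-trans F≐ ≐-reverse₄))))
  Cone⇒ (_ , -N∪-N-1∪1 , F≐) = inj₁ (itself (positive₁ (≐-trans F≐ ≐-reverse₄)))
  Cone⇒ (_ , -N∪-N-1∪-K , F≐) = inj₂ (antipode (_ , new-top , ≐-trans (neg-≐ F≐) ≐-reverse₄))
  Cone⇒ (_ , -N∪1∪-K , F≐) = inj₂ (antipode (_ , new-wrap , ≐-trans (neg-≐ F≐) ≐-swap₄))

  Fam1⇒Cone : ∀ {F} → Fam1 M F → WithAntipodes Cone F
  Fam1⇒Cone {F} (ascending₁ i 1≤i i≤K F≐) with ℕ.m≤n⇒m<n∨m≡n i≤K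
  ... | inj₁ (s≤s i≤k+1) = itself (_ , N∪ascending 1≤i i≤k+1 ,
    ≐-trans (subst (λ j → F ≐ (p i ∷ p j ∷ p N ∷ p M ∷ [])) (+1≡suc i) F≐) (≐-sym ≐-swap₄))
  ... | inj₂ refl = itself (_ , N∪N-1∪K ,
    ≐-trans (subst (λ j → F ≐ (p K ∷ p j ∷ p N ∷ p M ∷ [])) (+1≡suc K) F≐) ≐-reverse₄)
  Fam1⇒Cone {F} (descending₁ i 1≤i i≤K F≐) with ℕ.m≤n⇒m<n∨m≡n i≤K
  ... | inj₁ (s≤s i≤k+1) = itself (_ , N∪descending 1≤i i≤k+1 ,
    ≐-trans (subst (λ j → F ≐ (m i ∷ m j ∷ p N ∷ p M ∷ [])) (+1≡suc i) F≐) (≐-sym ≐-swap₄))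
  ... | inj₂ refl = itself (_ , N∪-N-1∪-K ,
    ≐-trans (subst (λ j → F ≐ (m K ∷ m j ∷ p N ∷ p M ∷ [])) (+1≡suc K) F≐) ≐-reverse₄)
  Fam1⇒Cone (closing₁ F≐) = itself (_ , N∪-N-1∪1 , ≐-trans F≐ ≐-reverse₄)
  Fam1⇒Cone (positive₁ F≐) = itself (_ , -N∪-N-1∪1 , ≐-trans F≐ ≐-reverse₄)
  Fam1⇒Cone (negative₁ F≐) = antipode (_ , N∪N-1∪-1 , ≐-trans (neg-≐ F≐) ≐-reverse₄)

  NewFace⇒Cone : ∀ {F} → NewFace F → WithAntipodes Cone F
  NewFace⇒Cone (_ , new-ascending 1≤i i≤k+1 , F≐) = itself (_ , edge∪N-1 (ascending 1≤i i≤k+1) , ≐-trans F≐ (≐-sym ≐-swap₄))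
  NewFace⇒Cone (_ , new-descending 1≤i i≤k+1 , F≐) = itself (_ , edge∪N-1 (descending 1≤i i≤k+1) , ≐-trans F≐ (≐-sym ≐-swap₄))
  NewFace⇒Cone (_ , new-closing , F≐) = itself (_ , edge∪N-1 closing , ≐-trans F≐ ≐-reverse₄)
  NewFace⇒Cone (_ , new-top , F≐) = antipode (_ , -N∪-N-1∪-K , ≐-trans (neg-≐ F≐) ≐-reverse₄)
  NewFace⇒Cone (_ , new-wrap , F≐) = antipode (_ , -N∪1∪-K , ≐-trans (neg-≐ F≐) (≐-sym ≐-swap₄))

  i+1<N-1⇒i≤k+1 : ∀ {i} → i + 1 < N-1 → i ≤ suc k
  i+1<N-1⇒i≤k+1 {i} i+1<N-1 = ℕ.≤-pred (ℕ.≤-pred (subst (_< N-1) (+1≡suc i) i+1<N-1))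

  i≤k+1⇒i+1<N-1 : ∀ {i} → i ≤ suc k → i + 1 < N-1
  i≤k+1⇒i+1<N-1 {i} i≤k+1 = subst (_< N-1) (sym (+1≡suc i)) (s≤s (s≤s i≤k+1))

  ascending-list : ∀ i → _≡_ {A = Face} (p i ∷ p (i + 1) ∷ p N-1 ∷ p (N-1 + 2) ∷ []) (p i ∷ p (suc i) ∷ p N-1 ∷ p M ∷ [])
  ascending-list i rewrite +1≡suc i | ℕ.+-comm k 2 = refl

  descending-list : ∀ i → _≡_ {A = Face} (m i ∷ m (i + 1) ∷ p N-1 ∷ p (N-1 + 2) ∷ []) (m i ∷ m (suc i) ∷ p N-1 ∷ p M ∷ [])
  descending-list i rewrite +1≡suc i | ℕ.+-comm k 2 = refl

  closing-list : _≡_ {A = Face} (p 1 ∷ m K ∷ p N-1 ∷ p (N-1 + 2) ∷ []) (p 1 ∷ m K ∷ p N-1 ∷ p M ∷ [])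
  closing-list rewrite ℕ.+-comm k 2 = refl

  top-list : _≡_ {A = Face} (p K ∷ p (K + 1) ∷ p (K + 2) ∷ m (K + 3) ∷ []) (p K ∷ p N-1 ∷ p N ∷ m M ∷ [])
  top-list rewrite ℕ.+-comm k 1 | ℕ.+-comm k 2 | ℕ.+-comm k 3 = refl

  wrap-list : _≡_ {A = Face} (m 1 ∷ p K ∷ p (K + 2) ∷ m (K + 3) ∷ []) (m 1 ∷ p K ∷ p N ∷ m M ∷ [])
  wrap-list rewrite ℕ.+-comm k 2 | ℕ.+-comm k 3 = refl

  Fam2-split : ∀ {G} → Fam2 M G → Fam2 N G ⊎ NewFace G
  Fam2-split {G} (ascending₂ i ℓ 1≤i i+1<ℓ ℓ≤N-1 G≐) with ℕ.m≤n⇒m<n∨m≡n ℓ≤N-1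
  ... | inj₁ (s≤s ℓ≤K) = inj₁ (ascending₂ i ℓ 1≤i i+1<ℓ ℓ≤K G≐)
  ... | inj₂ refl = inj₂ (_ , new-ascending 1≤i (i+1<N-1⇒i≤k+1 i+1<ℓ) , subst (G ≐_) (ascending-list i) G≐)
  Fam2-split {G} (descending₂ i ℓ 1≤i i+1<ℓ ℓ≤N-1 G≐) with ℕ.m≤n⇒m<n∨m≡n ℓ≤N-1
  ... | inj₁ (s≤s ℓ≤K) = inj₁ (descending₂ i ℓ 1≤i i+1<ℓ ℓ≤K G≐)
  ... | inj₂ refl = inj₂ (_ , new-descending 1≤i (i+1<N-1⇒i≤k+1 i+1<ℓ) , subst (G ≐_) (descending-list i) G≐)
  Fam2-split {G} (closing₂ i ℓ 1≤i i+1<ℓ ℓ≤N-1 G≐) with ℕ.m≤n⇒m<n∨m≡n ℓ≤N-1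
  ... | inj₁ (s≤s ℓ≤K) = inj₁ (closing₂ i ℓ 1≤i i+1<ℓ ℓ≤K G≐)
  ... | inj₂ refl = inj₂ (_ , new-closing , subst (G ≐_) closing-list G≐)
  Fam2-split {G} (top₂ ℓ 2≤ℓ ℓ≤K G≐) with ℕ.m≤n⇒m<n∨m≡n ℓ≤K
  ... | inj₁ (s≤s ℓ≤k+1) = inj₁ (top₂ ℓ 2≤ℓ ℓ≤k+1 G≐)
  ... | inj₂ refl = inj₂ (_ , new-top , subst (G ≐_) top-list G≐)
  Fam2-split {G} (wrap₂ ℓ 2≤ℓ ℓ≤K G≐) with ℕ.m≤n⇒m<n∨m≡n ℓ≤K
  ... | inj₁ (s≤s ℓ≤k+1) = inj₁ (wrap₂ ℓ 2≤ℓ ℓ≤k+1 G≐)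
  ... | inj₂ refl = inj₂ (_ , new-wrap , subst (G ≐_) wrap-list G≐)

  Fam2-weaken : ∀ {G} → Fam2 N G → Fam2 M G
  Fam2-weaken (ascending₂ i ℓ 1≤i i+1<ℓ ℓ≤ G≐) = ascending₂ i ℓ 1≤i i+1<ℓ (ℕ.m≤n⇒m≤1+n ℓ≤) G≐
  Fam2-weaken (descending₂ i ℓ 1≤i i+1<ℓ ℓ≤ G≐) = descending₂ i ℓ 1≤i i+1<ℓ (ℕ.m≤n⇒m≤1+n ℓ≤) G≐
  Fam2-weaken (closing₂ i ℓ 1≤i i+1<ℓ ℓ≤ G≐) = closing₂ i ℓ 1≤i i+1<ℓ (ℕ.m≤n⇒m≤1+n ℓ≤) G≐
  Fam2-weaken (top₂ ℓ 2≤ℓ ℓ≤ G≐) = top₂ ℓ 2≤ℓ (ℕ.m≤n⇒m≤1+n ℓ≤) G≐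
  Fam2-weaken (wrap₂ ℓ 2≤ℓ ℓ≤ G≐) = wrap₂ ℓ 2≤ℓ (ℕ.m≤n⇒m≤1+n ℓ≤) G≐

  NewFace⇒Fam2 : ∀ {G} → NewFace G → Fam2 M G
  NewFace⇒Fam2 {G} (_ , new-ascending {i} 1≤i i≤k+1 , G≐) =
    ascending₂ i N-1 1≤i (i≤k+1⇒i+1<N-1 i≤k+1) ℕ.≤-refl (subst (G ≐_) (sym (ascending-list i)) G≐)
  NewFace⇒Fam2 {G} (_ , new-descending {i} 1≤i i≤k+1 , G≐) =
    descending₂ i N-1 1≤i (i≤k+1⇒i+1<N-1 i≤k+1) ℕ.≤-refl (subst (G ≐_) (sym (descending-list i)) G≐)
  NewFace⇒Fam2 {G} (_ , new-closing , G≐) =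
    closing₂ 1 N-1 ℕ.≤-refl (i≤k+1⇒i+1<N-1 (s≤s z≤n)) ℕ.≤-refl (subst (G ≐_) (sym closing-list) G≐)
  NewFace⇒Fam2 {G} (_ , new-top , G≐) = top₂ K (s≤s (s≤s z≤n)) ℕ.≤-refl (subst (G ≐_) (sym top-list) G≐)
  NewFace⇒Fam2 {G} (_ , new-wrap , G≐) = wrap₂ K (s≤s (s≤s z≤n)) ℕ.≤-refl (subst (G ≐_) (sym wrap-list) G≐)

  ±Fam1-∋±N : ∀ {G} → WithAntipodes (Fam1 M) G → p N ∈ G ⊎ m N ∈ G
  ±Fam1-∋±N (itself G∈) = third G∈
    where
    third : ∀ {G} → Fam1 M G → p N ∈ G ⊎ m N ∈ G
    third (ascending₁ _ _ _ G≐) = inj₁ (proj₂ G≐ _ 3rd)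
    third (descending₁ _ _ _ G≐) = inj₁ (proj₂ G≐ _ 3rd)
    third (closing₁ G≐) = inj₁ (proj₂ G≐ _ 3rd)
    third (positive₁ G≐) = inj₂ (proj₂ G≐ _ 3rd)
    third (negative₁ G≐) = inj₂ (proj₂ G≐ _ 3rd)
  ±Fam1-∋±N {G} (antipode -G∈) with ±Fam1-∋±N (itself -G∈)
  ... | inj₁ N∈-G = inj₂ (∈-neg⁻ N∈-G)
  ... | inj₂ -N∈-G = inj₁ (∈-neg⁻ -N∈-G)

  ±Fam1-∋±M : ∀ {G} → WithAntipodes (Fam1 M) G → p M ∈ G ⊎ m M ∈ G
  ±Fam1-∋±M (itself G∈) = fourth G∈
    where
    fourth : ∀ {G} → Fam1 M G → p M ∈ G ⊎ m M ∈ G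
    fourth (ascending₁ _ _ _ G≐) = inj₁ (proj₂ G≐ _ 4th)
    fourth (descending₁ _ _ _ G≐) = inj₁ (proj₂ G≐ _ 4th)
    fourth (closing₁ G≐) = inj₁ (proj₂ G≐ _ 4th)
    fourth (positive₁ G≐) = inj₁ (proj₂ G≐ _ 4th)
    fourth (negative₁ G≐) = inj₂ (proj₂ G≐ _ 4th)
  ±Fam1-∋±M {G} (antipode -G∈) with ±Fam1-∋±M (itself -G∈)
  ... | inj₁ M∈-G = inj₂ (∈-neg⁻ M∈-G)
  ... | inj₂ -M∈-G = inj₁ (∈-neg⁻ -M∈-G)

  -- separates the last two kinds of New from ±(1)
  ±Fam1-∋M⊎-N⊎-1∧N-1 : ∀ {G} → WithAntipodes (Fam1 M) G → p M ∈ G ⊎ m N ∈ G ⊎ (m 1 ∈ G × p N-1 ∈ G)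
  ±Fam1-∋M⊎-N⊎-1∧N-1 (itself (ascending₁ _ _ _ G≐)) = inj₁ (proj₂ G≐ _ 4th)
  ±Fam1-∋M⊎-N⊎-1∧N-1 (itself (descending₁ _ _ _ G≐)) = inj₁ (proj₂ G≐ _ 4th)
  ±Fam1-∋M⊎-N⊎-1∧N-1 (itself (closing₁ G≐)) = inj₁ (proj₂ G≐ _ 4th)
  ±Fam1-∋M⊎-N⊎-1∧N-1 (itself (positive₁ G≐)) = inj₁ (proj₂ G≐ _ 4th)
  ±Fam1-∋M⊎-N⊎-1∧N-1 (itself (negative₁ G≐)) = inj₂ (inj₁ (proj₂ G≐ _ 3rd))
  ±Fam1-∋M⊎-N⊎-1∧N-1 (antipode (ascending₁ _ _ _ -G≐)) = inj₂ (inj₁ (∈-neg⁻ (proj₂ -G≐ _ 3rd)))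
  ±Fam1-∋M⊎-N⊎-1∧N-1 (antipode (descending₁ _ _ _ -G≐)) = inj₂ (inj₁ (∈-neg⁻ (proj₂ -G≐ _ 3rd)))
  ±Fam1-∋M⊎-N⊎-1∧N-1 (antipode (closing₁ -G≐)) = inj₂ (inj₁ (∈-neg⁻ (proj₂ -G≐ _ 3rd)))
  ±Fam1-∋M⊎-N⊎-1∧N-1 (antipode (positive₁ -G≐)) = inj₂ (inj₂ (∈-neg⁻ (proj₂ -G≐ _ 1st) , ∈-neg⁻ (proj₂ -G≐ _ 2nd)))
  ±Fam1-∋M⊎-N⊎-1∧N-1 (antipode (negative₁ -G≐)) = inj₁ (∈-neg⁻ (proj₂ -G≐ _ 4th))

  New-∉±Fam1 : ∀ {G} → NewFace G → ¬ WithAntipodes (Fam1 M) G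
  New-∉±Fam1 (_ , new-ascending {i} _ i≤k+1 , G≐) G∈ with ±Fam1-∋±N G∈
  ... | inj₁ N∈G = ∉-fromAll (small≢pN (ℕ.m≤n⇒m≤1+n i≤k+1) ∘ sym ∷ small≢pN (s≤s i≤k+1) ∘ sym ∷ (λ ()) ∷ (λ ()) ∷ []) (proj₁ G≐ _ N∈G)
  ... | inj₂ -N∈G = ∉-fromAll ((λ ()) ∷ (λ ()) ∷ (λ ()) ∷ (λ ()) ∷ []) (proj₁ G≐ _ -N∈G)
  New-∉±Fam1 (_ , new-descending {i} 1≤i i≤k+1 , G≐) G∈ with ±Fam1-∋±N G∈
  ... | inj₁ N∈G = ∉-fromAll (p≢m (s≤s z≤n) ∷ p≢m (s≤s z≤n) ∷ (λ ()) ∷ (λ ()) ∷ []) (proj₁ G≐ _ N∈G)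
  ... | inj₂ -N∈G = ∉-fromAll (small≢mN (ℕ.m≤n⇒m≤1+n i≤k+1) ∘ sym ∷ small≢mN (s≤s i≤k+1) ∘ sym ∷ (λ ()) ∷ (λ ()) ∷ []) (proj₁ G≐ _ -N∈G)
  New-∉±Fam1 (_ , new-closing , G≐) G∈ with ±Fam1-∋±N G∈
  ... | inj₁ N∈G = ∉-fromAll ((λ ()) ∷ (λ ()) ∷ (λ ()) ∷ (λ ()) ∷ []) (proj₁ G≐ _ N∈G)
  ... | inj₂ -N∈G = ∉-fromAll ((λ ()) ∷ m≢m (λ ()) ∷ (λ ()) ∷ (λ ()) ∷ []) (proj₁ G≐ _ -N∈G)
  New-∉±Fam1 (_ , new-top , G≐) G∈ with ±Fam1-∋M⊎-N⊎-1∧N-1 G∈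
  ... | inj₁ M∈G = ∉-fromAll ((λ ()) ∷ (λ ()) ∷ (λ ()) ∷ (λ ()) ∷ []) (proj₁ G≐ _ M∈G)
  ... | inj₂ (inj₁ -N∈G) = ∉-fromAll ((λ ()) ∷ (λ ()) ∷ (λ ()) ∷ m≢m (λ ()) ∷ []) (proj₁ G≐ _ -N∈G)
  ... | inj₂ (inj₂ (-1∈G , _)) = ∉-fromAll ((λ ()) ∷ (λ ()) ∷ (λ ()) ∷ m≢m (λ ()) ∷ []) (proj₁ G≐ _ -1∈G)
  New-∉±Fam1 (_ , new-wrap , G≐) G∈ with ±Fam1-∋M⊎-N⊎-1∧N-1 G∈
  ... | inj₁ M∈G = ∉-fromAll ((λ ()) ∷ (λ ()) ∷ (λ ()) ∷ (λ ()) ∷ []) (proj₁ G≐ _ M∈G)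
  ... | inj₂ (inj₁ -N∈G) = ∉-fromAll (m≢m (λ ()) ∷ (λ ()) ∷ (λ ()) ∷ m≢m (λ ()) ∷ []) (proj₁ G≐ _ -N∈G)
  ... | inj₂ (inj₂ (_ , N-1∈G)) = ∉-fromAll ((λ ()) ∷ (λ ()) ∷ (λ ()) ∷ (λ ()) ∷ []) (proj₁ G≐ _ N-1∈G)

  ±New-∉±Fam1 : ∀ {G} → WithAntipodes NewFace G → ¬ WithAntipodes (Fam1 M) G
  ±New-∉±Fam1 (itself new) = New-∉±Fam1 new
  ±New-∉±Fam1 (antipode new) = New-∉±Fam1 new ∘ WithAntipodes-neg {P = Fam1 M}

-- Induction on n

Families : ℕ → Face → Set
Families n = WithAntipodes (λ G → Fam1 n G ⊎ Fam2 n G ⊎ Fam3 G)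

-- the facets of Δ³ₙ that survive into Δ³ₙ₊₁
Rest : ℕ → Face → Set
Rest n = WithAntipodes (λ G → Fam2 n G ⊎ Fam3 G)

Families⇒Fam1⊎Rest : ∀ {n F} → Families n F → WithAntipodes (Fam1 n) F ⊎ Rest n F
Families⇒Fam1⊎Rest (itself (inj₁ F∈)) = inj₁ (itself F∈)
Families⇒Fam1⊎Rest (itself (inj₂ F∈)) = inj₂ (itself F∈)
Families⇒Fam1⊎Rest (antipode (inj₁ -F∈)) = inj₁ (antipode -F∈)
Families⇒Fam1⊎Rest (antipode (inj₂ -F∈)) = inj₂ (antipode -F∈)

Rest⇒Families : ∀ {n F} → Rest n F → Families n F
Rest⇒Families (itself F∈) = itself (inj₂ F∈)
Rest⇒Families (antipode -F∈) = antipode (inj₂ -F∈)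

Fam1⇒Families : ∀ {n F} → WithAntipodes (Fam1 n) F → Families n F
Fam1⇒Families (itself F∈) = itself (fam1 F∈)
Fam1⇒Families (antipode -F∈) = antipode (fam1 -F∈)

Fam2⇒Rest : ∀ {n F} → WithAntipodes (Fam2 n) F → Rest n F
Fam2⇒Rest (itself F∈) = itself (inj₁ F∈)
Fam2⇒Rest (antipode -F∈) = antipode (inj₁ -F∈)

record Invariant (n : ℕ) : Set where
  field
    Δ3⁻ : ∀ {F} → Generator (Δ3 n) F → Families n F
    Δ3⁺ : ∀ {F} → Families n F → Generator (Δ3 n) F
    Δ3-HasSize : ∀ {F} → Generator (Δ3 n) F → HasSize 4 F
    Δ3-Bounded : ∀ {F} → Generator (Δ3 n) F → Bounded n F
    Union2⁻ : ∀ {F} → Generator (Union2 n) F → WithAntipodes (Fam2 n) F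
    Union2⁺ : ∀ {F} → WithAntipodes (Fam2 n) F → Generator (Union2 n) F
    Rest-∉Fam1 : ∀ {F} → Rest n F → ¬ WithAntipodes (Fam1 n) F

Layer : ℕ → Cx
Layer s = pm (join (p s) (∂ (B31 (s ∸ 1)))) ∖ pm (B31 s)

Union2-suc : ∀ k → Union2 (5 + k) ≡ Union2 (4 + k) ++ Layer (5 + k)
Union2-suc k = begin
    concatMap Layer (applyUpTo (5 +_) (suc k))
  ≡⟨ cong (concatMap Layer) (sym (List.applyUpTo-∷ʳ (5 +_) k)) ⟩
    concatMap Layer (applyUpTo (5 +_) k ++ [ 5 + k ])
  ≡⟨ List.concatMap-++ Layer (applyUpTo (5 +_) k) [ 5 + k ] ⟩
    Union2 (4 + k) ++ (Layer (5 + k) ++ [])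
  ≡⟨ cong (Union2 (4 + k) ++_) (List.++-identityʳ (Layer (5 + k))) ⟩
    Union2 (4 + k) ++ Layer (5 + k)
  ∎
  where open ≡-Reasoning

module Induction (k : ℕ) (inv : Invariant (4 + k)) where
  open Step k
  open Invariant inv
  private module Next = Facets (suc k)

  Survivors Cones : Cx
  Survivors = Δ3 N ∖ pm (B31 N)
  Cones = join (p M) (∂ (B31 N)) ++ join (m M) (∂ (negC (B31 N)))

  Generator-Cones⁻ : ∀ {F} → Generator Cones F → WithAntipodes Cone F
  Generator-Cones⁻ F-gen with Generator-++⁻ (join (p M) (∂ (B31 N))) F-gen
  ... | inj₁ F-gen′ = itself (Generator-cone⁻ F-gen′)
  ... | inj₂ F-gen′ = antipode (Generator-antipodal-cone⁻ F-gen′)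

  Generator-Cones⁺ : ∀ {F} → WithAntipodes Cone F → Generator Cones F
  Generator-Cones⁺ (itself cone) = Generator-++⁺ˡ (Generator-cone⁺ cone)
  Generator-Cones⁺ (antipode cone) = Generator-++⁺ʳ (join (p M) (∂ (B31 N))) (Generator-antipodal-cone⁺ cone)

  classify-±Cone : ∀ {F} → WithAntipodes Cone F → WithAntipodes (Fam1 M) F ⊎ WithAntipodes NewFace F
  classify-±Cone (itself cone) = Cone⇒ cone
  classify-±Cone (antipode cone) with Cone⇒ cone
  ... | inj₁ -F∈ = inj₁ (WithAntipodes-neg⁻ {P = Fam1 M} -F∈)
  ... | inj₂ -F∈ = inj₂ (WithAntipodes-neg⁻ {P = NewFace} -F∈)

  ±New⇒Families : ∀ {F} → WithAntipodes NewFace F → Families M F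
  ±New⇒Families (itself F∈) = itself (fam2 (NewFace⇒Fam2 F∈))
  ±New⇒Families (antipode -F∈) = antipode (fam2 (NewFace⇒Fam2 -F∈))

  ±New⇒±Cone : ∀ {F} → WithAntipodes NewFace F → WithAntipodes Cone F
  ±New⇒±Cone (itself F∈) = NewFace⇒Cone F∈
  ±New⇒±Cone (antipode -F∈) = WithAntipodes-neg⁻ {P = Cone} (NewFace⇒Cone -F∈)

  ±Fam1⇒±Cone : ∀ {F} → WithAntipodes (Fam1 M) F → WithAntipodes Cone F
  ±Fam1⇒±Cone (itself F∈) = Fam1⇒Cone F∈
  ±Fam1⇒±Cone (antipode -F∈) = WithAntipodes-neg⁻ {P = Cone} (Fam1⇒Cone -F∈)

  Rest-lift : ∀ {F} → Rest N F → Families M F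
  Rest-lift (itself (inj₁ F∈)) = itself (fam2 (Fam2-weaken F∈))
  Rest-lift (itself (inj₂ F∈)) = itself (fam3 F∈)
  Rest-lift (antipode (inj₁ -F∈)) = antipode (fam2 (Fam2-weaken -F∈))
  Rest-lift (antipode (inj₂ -F∈)) = antipode (fam3 -F∈)

  Rest-split : ∀ {F} → Rest M F → Rest N F ⊎ WithAntipodes NewFace F
  Rest-split (itself (inj₂ F∈)) = inj₁ (itself (inj₂ F∈))
  Rest-split (antipode (inj₂ -F∈)) = inj₁ (antipode (inj₂ -F∈))
  Rest-split (itself (inj₁ F∈)) with Fam2-split F∈
  ... | inj₁ F∈′ = inj₁ (itself (inj₁ F∈′))
  ... | inj₂ new = inj₂ (itself new)
  Rest-split (antipode (inj₁ -F∈)) with Fam2-split -F∈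
  ... | inj₁ -F∈′ = inj₁ (antipode (inj₁ -F∈′))
  ... | inj₂ new = inj₂ (antipode new)

  ±Fam2-split : ∀ {F} → WithAntipodes (Fam2 M) F → WithAntipodes (Fam2 N) F ⊎ WithAntipodes NewFace F
  ±Fam2-split (itself F∈) with Fam2-split F∈
  ... | inj₁ F∈′ = inj₁ (itself F∈′)
  ... | inj₂ new = inj₂ (itself new)
  ±Fam2-split (antipode -F∈) with Fam2-split -F∈
  ... | inj₁ -F∈′ = inj₁ (antipode -F∈′)
  ... | inj₂ new = inj₂ (antipode new)

  Rest-∉±B31 : ∀ {F} → Rest N F → ¬ FaceOf (pm (B31 N)) F
  Rest-∉±B31 rest F∈B = Rest-∉Fam1 rest (FaceOf-±B31 (Δ3-HasSize (Δ3⁺ (Rest⇒Families rest))) F∈B)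

  ±New-∉±B31 : ∀ {F} → WithAntipodes NewFace F → ¬ FaceOf (pm (B31 M)) F
  ±New-∉±B31 new F∈B = ±New-∉±Fam1 new
    (Next.FaceOf-±B31 (HasSize-WithAntipodes Cone-HasSize (±New⇒±Cone new)) F∈B)

  Δ3M⁻ : ∀ {F} → Generator (Δ3 M) F → Families M F
  Δ3M⁻ F-gen = [ survivor , cone ]′ (Generator-++⁻ Survivors F-gen)
    where
    survivor : ∀ {F} → Generator Survivors F → Families M F
    survivor F-gen =
      let F∈Δ3 , F∉B = Generator-∖⁻ (Δ3 N) (pm (B31 N)) F-gen
      in [ (λ F∈ → ⊥-elim (F∉B (Generator⇒FaceOf (Generator-±B31⁺ F∈)))) , Rest-lift ]′ (Families⇒Fam1⊎Rest (Δ3⁻ F∈Δ3))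
    cone : ∀ {F} → Generator Cones F → Families M F
    cone F-gen = [ Fam1⇒Families , ±New⇒Families ]′ (classify-±Cone (Generator-Cones⁻ F-gen))

  Δ3M⁺ : ∀ {F} → Families M F → Generator (Δ3 M) F
  Δ3M⁺ F∈ = [ (λ F∈′ → cone (±Fam1⇒±Cone F∈′)) , rest ]′ (Families⇒Fam1⊎Rest F∈)
    where
    cone : ∀ {F} → WithAntipodes Cone F → Generator (Δ3 M) F
    cone F∈ = Generator-++⁺ʳ Survivors (Generator-Cones⁺ F∈)
    survivor : ∀ {F} → Rest N F → Generator (Δ3 M) F
    survivor old = Generator-++⁺ˡ (Generator-∖⁺ (Δ3 N) (pm (B31 N)) (Δ3⁺ (Rest⇒Families old)) (Rest-∉±B31 old))
    rest : ∀ {F} → Rest M F → Generator (Δ3 M) F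
    rest F∈ = [ survivor , (λ new → cone (±New⇒±Cone new)) ]′ (Rest-split F∈)

  Δ3M-HasSize : ∀ {F} → Generator (Δ3 M) F → HasSize 4 F
  Δ3M-HasSize F-gen = [ survivor , cone ]′ (Generator-++⁻ Survivors F-gen)
    where
    survivor : ∀ {F} → Generator Survivors F → HasSize 4 F
    survivor F-gen = Δ3-HasSize (proj₁ (Generator-∖⁻ (Δ3 N) (pm (B31 N)) F-gen))
    cone : ∀ {F} → Generator Cones F → HasSize 4 F
    cone F-gen = HasSize-WithAntipodes Cone-HasSize (Generator-Cones⁻ F-gen)

  Δ3M-Bounded : ∀ {F} → Generator (Δ3 M) F → Bounded M F
  Δ3M-Bounded F-gen = [ survivor , cone ]′ (Generator-++⁻ Survivors F-gen)
    where
    survivor : ∀ {F} → Generator Survivors F → Bounded M F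
    survivor F-gen = Bounded-mono (ℕ.n≤1+n N) (Δ3-Bounded (proj₁ (Generator-∖⁻ (Δ3 N) (pm (B31 N)) F-gen)))
    cone : ∀ {F} → Generator Cones F → Bounded M F
    cone F-gen = Bounded-WithAntipodes Cone-Bounded (Generator-Cones⁻ F-gen)

  Union2M⁻ : ∀ {F} → Generator (Union2 M) F → WithAntipodes (Fam2 M) F
  Union2M⁻ {F} F-gen = [ (λ F∈Union2 → WithAntipodes-map {P = Fam2 N} Fam2-weaken (Union2⁻ F∈Union2)) , from-layer ]′
                       (Generator-++⁻ (Union2 N) (subst (λ Γ → Generator Γ F) (Union2-suc k) F-gen))
    where
    from-cone : ∀ {F} → ¬ FaceOf (pm (B31 M)) F → WithAntipodes (Fam1 M) F ⊎ WithAntipodes NewFace F → WithAntipodes (Fam2 M) F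
    from-cone F∉B (inj₁ F∈) = ⊥-elim (F∉B (Generator⇒FaceOf (Next.Generator-±B31⁺ F∈)))
    from-cone F∉B (inj₂ new) = WithAntipodes-map {P = NewFace} NewFace⇒Fam2 new
    from-layer : ∀ {F} → Generator (Layer M) F → WithAntipodes (Fam2 M) F
    from-layer F∈Layer =
      let F∈±cone , F∉B = Generator-∖⁻ (pm (join (p M) (∂ (B31 N)))) (pm (B31 M)) F∈Layer
      in from-cone F∉B (classify-±Cone (WithAntipodes-map {P = Generator (join (p M) (∂ (B31 N)))} Generator-cone⁻
                                        (Generator-pm⁻ (join (p M) (∂ (B31 N))) F∈±cone)))

  Union2M⁺ : ∀ {F} → WithAntipodes (Fam2 M) F → Generator (Union2 M) F
  Union2M⁺ {F} F∈ = subst (λ Γ → Generator Γ F) (sym (Union2-suc k)) (Generator-in-halves (±Fam2-split F∈))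
    where
    Generator-in-halves : WithAntipodes (Fam2 N) F ⊎ WithAntipodes NewFace F → Generator (Union2 N ++ Layer M) F
    Generator-in-halves (inj₁ old) = Generator-++⁺ˡ (Union2⁺ old)
    Generator-in-halves (inj₂ new) = Generator-++⁺ʳ (Union2 N)
      (Generator-∖⁺ (pm (join (p M) (∂ (B31 N)))) (pm (B31 M))
        (Generator-pm⁺ (join (p M) (∂ (B31 N))) (WithAntipodes-map {P = Cone} Generator-cone⁺ (±New⇒±Cone new)))
        (±New-∉±B31 new))

  RestM-∉Fam1 : ∀ {F} → Rest M F → ¬ WithAntipodes (Fam1 M) F
  RestM-∉Fam1 rest F∈ with Rest-split rest
  ... | inj₂ new = ±New-∉±Fam1 new F∈
  ... | inj₁ old with ±Fam1-∋±M F∈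
  ...   | inj₁ M∈F = Bounded-∌ (Δ3-Bounded (Δ3⁺ (Rest⇒Families old))) ℕ.≤-refl M∈F
  ...   | inj₂ -M∈F = Bounded-∌ (Δ3-Bounded (Δ3⁺ (Rest⇒Families old))) ℕ.≤-refl -M∈F

  invariant : Invariant M
  invariant = record
    { Δ3⁻ = Δ3M⁻ ; Δ3⁺ = Δ3M⁺ ; Δ3-HasSize = Δ3M-HasSize ; Δ3-Bounded = Δ3M-Bounded
    ; Union2⁻ = Union2M⁻ ; Union2⁺ = Union2M⁺ ; Rest-∉Fam1 = RestM-∉Fam1 }

-- The case n = 4

family1-4 family3 : Cx
family1-4 = (p 1 ∷ p 2 ∷ p 3 ∷ p 4 ∷ []) ∷ (m 1 ∷ m 2 ∷ p 3 ∷ p 4 ∷ []) ∷ (p 1 ∷ m 2 ∷ p 3 ∷ p 4 ∷ [])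
       ∷ (p 1 ∷ m 2 ∷ m 3 ∷ p 4 ∷ []) ∷ (p 1 ∷ m 2 ∷ m 3 ∷ m 4 ∷ []) ∷ []
family3 = (p 1 ∷ p 2 ∷ m 3 ∷ p 4 ∷ []) ∷ (p 1 ∷ p 2 ∷ p 3 ∷ m 4 ∷ []) ∷ (p 1 ∷ m 2 ∷ p 3 ∷ m 4 ∷ []) ∷ []

Fam1-4⇒Generator : ∀ {F} → Fam1 4 F → Generator family1-4 F
Fam1-4⇒Generator (ascending₁ 1 _ _ F≐) = here F≐
Fam1-4⇒Generator (descending₁ 1 _ _ F≐) = there (here F≐)
Fam1-4⇒Generator (closing₁ F≐) = there (there (here F≐))
Fam1-4⇒Generator (positive₁ F≐) = there (there (there (here F≐)))
Fam1-4⇒Generator (negative₁ F≐) = there (there (there (there (here F≐))))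
Fam1-4⇒Generator (ascending₁ (suc (suc _)) _ (s≤s ()) _)
Fam1-4⇒Generator (descending₁ (suc (suc _)) _ (s≤s ()) _)

Generator⇒Fam1-4 : ∀ {F} → Generator family1-4 F → Fam1 4 F
Generator⇒Fam1-4 (here F≐) = ascending₁ 1 (s≤s z≤n) (s≤s z≤n) F≐
Generator⇒Fam1-4 (there (here F≐)) = descending₁ 1 (s≤s z≤n) (s≤s z≤n) F≐
Generator⇒Fam1-4 (there (there (here F≐))) = closing₁ F≐
Generator⇒Fam1-4 (there (there (there (here F≐)))) = positive₁ F≐
Generator⇒Fam1-4 (there (there (there (there (here F≐))))) = negative₁ F≐

Fam3⇒Generator : ∀ {F} → Fam3 F → Generator family3 F
Fam3⇒Generator (inj₁ F≐) = here F≐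
Fam3⇒Generator (inj₂ (inj₁ F≐)) = there (here F≐)
Fam3⇒Generator (inj₂ (inj₂ F≐)) = there (there (here F≐))

Generator⇒Fam3 : ∀ {F} → Generator family3 F → Fam3 F
Generator⇒Fam3 (here F≐) = inj₁ F≐
Generator⇒Fam3 (there (here F≐)) = inj₂ (inj₁ F≐)
Generator⇒Fam3 (there (there (here F≐))) = inj₂ (inj₂ F≐)

no-room : ∀ {i ℓ} → 1 ≤ i → i + 1 < ℓ → ¬ ℓ ≤ 2
no-room 1≤i i+1<ℓ ℓ≤2 = ℕ.<-irrefl refl (ℕ.≤-<-trans (ℕ.+-monoˡ-≤ 1 1≤i) (ℕ.<-≤-trans i+1<ℓ ℓ≤2))

Fam2-4-empty : ∀ {F} → ¬ Fam2 4 F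
Fam2-4-empty (ascending₂ _ _ 1≤i i+1<ℓ ℓ≤2 _) = no-room 1≤i i+1<ℓ ℓ≤2
Fam2-4-empty (descending₂ _ _ 1≤i i+1<ℓ ℓ≤2 _) = no-room 1≤i i+1<ℓ ℓ≤2
Fam2-4-empty (closing₂ _ _ 1≤i i+1<ℓ ℓ≤2 _) = no-room 1≤i i+1<ℓ ℓ≤2
Fam2-4-empty (top₂ _ 2≤ℓ ℓ≤1 _) with ℕ.≤-trans 2≤ℓ ℓ≤1
... | s≤s ()
Fam2-4-empty (wrap₂ _ 2≤ℓ ℓ≤1 _) with ℕ.≤-trans 2≤ℓ ℓ≤1
... | s≤s ()


-- The following facts about n = 4 are decided by evaluation.
Δ3-4⊑ : T (Δ3 4 ⊑ᵇ pm (family1-4 ++ family3))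
Δ3-4⊑ = _

⊑Δ3-4 : T (pm (family1-4 ++ family3) ⊑ᵇ Δ3 4)
⊑Δ3-4 = _

fam3-disjoint-fam1 : T (disjointᵇ (pm family3) (pm family1-4))
fam3-disjoint-fam1 = _

Δ3-4∖±B31⊑ : T ((Δ3 4 ∖ pm (B31 4)) ⊑ᵇ pm family3)
Δ3-4∖±B31⊑ = _

⊑Δ3-4∖±B31 : T (pm family3 ⊑ᵇ (Δ3 4 ∖ pm (B31 4)))
⊑Δ3-4∖±B31 = _

Δ3-4-sized : All (λ G → Unique G × length G ≡ 4) (Δ3 4)
Δ3-4-sized = toWitness {a? = All.all? (λ G → unique? G ×-dec (length G ℕ.≟ 4)) (Δ3 4)} _

Δ3-4-bounded : All (All (λ x → ∣ x ∣ ≤ 4)) (Δ3 4)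
Δ3-4-bounded = toWitness {a? = All.all? (All.all? (λ x → ∣ x ∣ ℕ.≤? 4)) (Δ3 4)} _

Generator-lists⇒ : ∀ {G} → Generator (family1-4 ++ family3) G → Fam1 4 G ⊎ Fam2 4 G ⊎ Fam3 G
Generator-lists⇒ G∈ with Generator-++⁻ family1-4 G∈
... | inj₁ G∈1 = fam1 (Generator⇒Fam1-4 G∈1)
... | inj₂ G∈3 = fam3 (Generator⇒Fam3 G∈3)

⇒Generator-lists : ∀ {G} → Fam1 4 G ⊎ Fam2 4 G ⊎ Fam3 G → Generator (family1-4 ++ family3) G
⇒Generator-lists (fam1 G∈) = Generator-++⁺ˡ (Fam1-4⇒Generator G∈)
⇒Generator-lists (fam2 G∈) = ⊥-elim (Fam2-4-empty G∈)
⇒Generator-lists (fam3 G∈) = Generator-++⁺ʳ family1-4 (Fam3⇒Generator G∈)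

Rest-4⇒Generator : ∀ {F} → Rest 4 F → Generator (pm family3) F
Rest-4⇒Generator (itself (inj₁ F∈)) = ⊥-elim (Fam2-4-empty F∈)
Rest-4⇒Generator (itself (inj₂ F∈)) = Generator-pm⁺ family3 (itself (Fam3⇒Generator F∈))
Rest-4⇒Generator (antipode (inj₁ -F∈)) = ⊥-elim (Fam2-4-empty -F∈)
Rest-4⇒Generator (antipode (inj₂ -F∈)) = Generator-pm⁺ family3 (antipode (Fam3⇒Generator -F∈))

invariant-4 : Invariant 4
invariant-4 = record
  { Δ3⁻ = λ F-gen → WithAntipodes-map {P = Generator (family1-4 ++ family3)} Generator-lists⇒
                      (Generator-pm⁻ (family1-4 ++ family3) (⊑ᵇ-sound (Δ3 4) _ Δ3-4⊑ F-gen))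
  ; Δ3⁺ = λ F∈ → ⊑ᵇ-sound _ (Δ3 4) ⊑Δ3-4
                   (Generator-pm⁺ (family1-4 ++ family3) (WithAntipodes-map {Q = Generator (family1-4 ++ family3)} ⇒Generator-lists F∈))
  ; Δ3-HasSize = λ F-gen → let G , G∈ , F≐G = find F-gen
                               G! , ∣G∣ = All.lookup Δ3-4-sized G∈
                           in G , G! , ∣G∣ , F≐G
  ; Δ3-Bounded = λ F-gen → let G , G∈ , F≐G = find F-gen in Bounded-⊆ (proj₁ F≐G) (Bounded-fromAll (All.lookup Δ3-4-bounded G∈))
  ; Union2⁻ = λ ()
  ; Union2⁺ = λ { (itself F∈) → ⊥-elim (Fam2-4-empty F∈) ; (antipode -F∈) → ⊥-elim (Fam2-4-empty -F∈) }
  ; Rest-∉Fam1 = λ rest F∈ → disjointᵇ-sound (pm family3) (pm family1-4) fam3-disjoint-fam1 (Rest-4⇒Generator rest)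
                               (Generator-pm⁺ family1-4 (WithAntipodes-map {Q = Generator family1-4} Fam1-4⇒Generator F∈))
  }

invariant : ∀ k → Invariant (4 + k)
invariant zero = invariant-4
invariant (suc k) = Induction.invariant k (invariant k)

lemma3p1 : (n : ℕ) → 4 ≤ n →
    (∀ F → IsFacet (Δ3 n) F ⇔ WithAntipodes (λ G → Fam1 n G ⊎ Fam2 n G ⊎ Fam3 G) F)
  × (∀ F → IsFacet (pm (B31 n)) F ⇔ WithAntipodes (Fam1 n) F)
  × (∀ F → IsFacet (Union2 n) F ⇔ WithAntipodes (Fam2 n) F)
  × (∀ F → IsFacet (Δ3 4 ∖ pm (B31 4)) F ⇔ WithAntipodes Fam3 F)
lemma3p1 (suc (suc (suc (suc k)))) _ =
    facets-characterised (Families n) (λ _ → mk⇔ Δ3⁻ Δ3⁺) (Δ3-HasSize ∘ Δ3⁺)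
  , facets-characterised (WithAntipodes (Fam1 n)) (λ _ → mk⇔ Generator-±B31⁻ Generator-±B31⁺)
      (HasSize-WithAntipodes Fam1-HasSize)
  , facets-characterised (WithAntipodes (Fam2 n)) (λ _ → mk⇔ Union2⁻ Union2⁺)
      (Δ3-HasSize ∘ Δ3⁺ ∘ Rest⇒Families ∘ Fam2⇒Rest {n})
  , facets-characterised (WithAntipodes Fam3) (λ _ → mk⇔ base⁻ base⁺)
      (Invariant.Δ3-HasSize invariant-4 ∘ proj₁ ∘ Generator-∖⁻ (Δ3 4) (pm (B31 4)) ∘ base⁺)
  where
  n : ℕ
  n = 4 + k
  open Invariant (invariant k)
  open Facets k using (Generator-±B31⁻; Generator-±B31⁺; Fam1-HasSize)
  base⁻ : ∀ {F} → Generator (Δ3 4 ∖ pm (B31 4)) F → WithAntipodes Fam3 F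
  base⁻ = WithAntipodes-map {P = Generator family3} Generator⇒Fam3
        ∘ Generator-pm⁻ family3 ∘ ⊑ᵇ-sound (Δ3 4 ∖ pm (B31 4)) (pm family3) Δ3-4∖±B31⊑
  base⁺ : ∀ {F} → WithAntipodes Fam3 F → Generator (Δ3 4 ∖ pm (B31 4)) F
  base⁺ = ⊑ᵇ-sound (pm family3) (Δ3 4 ∖ pm (B31 4)) ⊑Δ3-4∖±B31
        ∘ Generator-pm⁺ family3 ∘ WithAntipodes-map {Q = Generator family3} Fam3⇒Generator
lemma3p1 (suc zero) (s≤s ())
lemma3p1 (suc (suc zero)) (s≤s (s≤s ()))
lemma3p1 (suc (suc (suc zero))) (s≤s (s≤s (s≤s ())))
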